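{- For every prime $p$, $\mathscr{U}(p)\supset\mathscr{A}(p)$.
   Context: Let $p$ be a prime and $r\ge 2$. Let $x_1,\dots,x_r$ be independent indeterminates over $\mathbb{F}_p$ and $f(x)=(x-x_1)\cdots(x-x_r)$. For $e\ge0$ write $f(x)^e=\sum_{i\ge0}c_ix^i$ and for $0\le d\le p$ let $M_d(f(x)^e)$ be the $d\times d$ matrix with $(i,j)$ entry $c_{ip+j-d-1}$. Put $\delta=\prod_{1\le i<j\le r}(x_i-x_j)$. $\mathscr{A}(p)$ is the set of $(r,e,d)\in\mathbb{Z}^3$ with $r\ge2$, $e\ge1$, $1\le d\le p$, such that there exist $\varepsilon\in\mathbb{F}_p^\times$ and a positive integer $g$ with $\det M_d(f(x)^e)=\varepsilon\,\delta^g$. For $(r,e,d)$ put $g=\left\{red-\frac{d(d+1)}{2}(p-1)\right\}\Big/\frac{r(r-1)}{2}$. $\mathscr{U}(p)$ is the set of $(r,e,d)\in\mathbb{Z}^3$ with $r\ge2$, $e\ge1$, $1\le d\le p$, $d(p-1)\le re\le r(p-1)$, $g>0$, and $g\in2\mathbb{Z}$ when $p\ne2$, $g\in\mathbb{Z}$ when $p=2$. -}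

module Defs where

open import Data.Nat as ℕ using (ℕ; zero; suc; _≤_; _<_; _∸_)
open import Data.Integer as ℤ using (ℤ; +_)
open import Data.Integer.Divisibility as ℤD using ()
open import Data.Fin as Fin using (Fin; toℕ; punchIn)
open import Data.Vec as Vec using (Vec; []; _∷_)
open import Data.Vec.Properties using (≡-dec)
open import Data.List as List using (List; []; _∷_)
open import Data.Product using (_×_; _,_; Σ)
open import Data.Bool using (if_then_else_)
open import Relation.Nullary using (¬_; does)
open import Relation.Binary.PropositionalEquality using (_≡_)

-- Equality in
-- F_p[x_1..x_n] is coefficientwise congruence mod p (_≈[_]_ below), so
-- this models F_p[x_1..x_n] faithfully (via the reduction Z[x] → F_p[x]).

Term : ℕ → Set
Term n = ℤ × Vec ℕ n

Poly : ℕ → Set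
Poly n = List (Term n)

coeff : ∀ {n} → Poly n → Vec ℕ n → ℤ
coeff [] m = + 0
coeff ((c , a) ∷ P) m =
  if does (≡-dec ℕ._≟_ a m) then c ℤ.+ coeff P m else coeff P m

_≈[_]_ : ∀ {n} → Poly n → ℕ → Poly n → Set
P ≈[ p ] Q = ∀ m → (+ p) ℤD.∣ (coeff P m ℤ.- coeff Q m)

constₚ : ∀ {n} → ℤ → Poly n
constₚ c = (c , Vec.replicate _ 0) ∷ []

1ₚ : ∀ {n} → Poly n
1ₚ = constₚ (+ 1)

var : ∀ {n} → Fin n → Poly n
var i = (+ 1 , Vec.tabulate (λ j → if does (i Fin.≟ j) then 1 else 0)) ∷ []

_+ₚ_ : ∀ {n} → Poly n → Poly n → Poly n
P +ₚ Q = P List.++ Q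

-ₚ_ : ∀ {n} → Poly n → Poly n
-ₚ P = List.map (λ { (c , a) → (ℤ.- c , a) }) P

_-ₚ_ : ∀ {n} → Poly n → Poly n → Poly n
P -ₚ Q = P +ₚ (-ₚ Q)

_*ₚ_ : ∀ {n} → Poly n → Poly n → Poly n
P *ₚ Q = List.concatMap
  (λ { (c , a) → List.map (λ { (c′ , b) → (c ℤ.* c′ , Vec.zipWith ℕ._+_ a b) }) Q }) P

powₚ : ∀ {n} → Poly n → ℕ → Poly n
powₚ P zero = 1ₚ
powₚ P (suc k) = P *ₚ powₚ P k

sumFin : ∀ {k n} → (Fin n → Poly k) → Poly k
sumFin {n = zero} f = []
sumFin {n = suc n} f = f Fin.zero +ₚ sumFin (λ i → f (Fin.suc i))

prodFin : ∀ {k n} → (Fin n → Poly k) → Poly k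
prodFin {n = zero} f = 1ₚ
prodFin {n = suc n} f = f Fin.zero *ₚ prodFin (λ i → f (Fin.suc i))

det : ∀ {k n} → (Fin n → Fin n → Poly k) → Poly k
det {n = zero} M = 1ₚ
det {n = suc n} M = sumFin (λ j →
  constₚ ((ℤ.- (+ 1)) ℤ.^ toℕ j) *ₚ
    (M Fin.zero j *ₚ det (λ a b → M (Fin.suc a) (punchIn j b))))

-- The setting.  Polynomials in r+1 indeterminates: index 0 is x,
-- index (suc i) is x_{i+1}.

fpoly : (r : ℕ) → Poly (suc r)
fpoly r = prodFin (λ (i : Fin r) → var Fin.zero -ₚ var (Fin.suc i))

coeffX : ∀ {r} → ℕ → Poly (suc r) → Poly r
coeffX k [] = []
coeffX k ((c , (a ∷ as)) ∷ P) =
  if a ℕ.≡ᵇ k then (c , as) ∷ coeffX k P else coeffX k P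

cf : (r e i : ℕ) → Poly r
cf r e i = coeffX i (powₚ (fpoly r) e)

-- M_d(f(x)^e): entry (i,j) (1-indexed) is c_{ip+j-d-1}; here i,j : Fin d
-- are 0-indexed, so the index is (i+1)p + (j+1) - d - 1 = (i+1)p + j - d
-- (no truncation occurs since d ≤ p).
Mmat : (p r e d : ℕ) → Fin d → Fin d → Poly r
Mmat p r e d i j = cf r e (suc (toℕ i) ℕ.* p ℕ.+ toℕ j ∸ d)

δ : (r : ℕ) → Poly r
δ r = prodFin (λ (i : Fin r) → prodFin (λ (j : Fin r) →
  if toℕ i ℕ.<ᵇ toℕ j then var i -ₚ var j else 1ₚ))

-- (r,e,d) ∈ 𝒜(p)   (ε ranges over representatives 1..p-1 of F_p^×)
InA : (p r e d : ℕ) → Set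
InA p r e d =
  2 ≤ r × 1 ≤ e × 1 ≤ d × d ≤ p ×
  Σ ℕ (λ ε → 1 ≤ ε × ε < p × Σ ℕ (λ g → 1 ≤ g ×
    det (Mmat p r e d) ≈[ p ] (constₚ (+ ε) *ₚ powₚ (δ r) g)))

-- (r,e,d) ∈ 𝒰(p).  g = {red - d(d+1)/2 (p-1)} / (r(r-1)/2) is required to be
-- an integer: it is the unique integer g with g·r(r-1) = 2red - d(d+1)(p-1).
InU : (p r e d : ℕ) → Set
InU p r e d =
  2 ≤ r × 1 ≤ e × 1 ≤ d × d ≤ p ×
  d ℕ.* (p ∸ 1) ≤ r ℕ.* e × r ℕ.* e ≤ r ℕ.* (p ∸ 1) ×
  Σ ℤ (λ g →
    g ℤ.* (+ (r ℕ.* (r ∸ 1))) ≡ (+ (2 ℕ.* r ℕ.* e ℕ.* d)) ℤ.- (+ (d ℕ.* (d ℕ.+ 1) ℕ.* (p ∸ 1))) ×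
    + 0 ℤ.< g ×
    (¬ p ≡ 2 → (+ 2) ℤD.∣ g))

-- Write M for M_d(f^e), so that det M ≡ ε·δ^g, and order monomials by the weight Σ i·aᵢ.
-- The heavier term of each factor xᵢ − xⱼ (i < j) of δ is −xⱼ, so the heaviest part of δ^g
-- is a single monomial μ with coefficient ±1, and x₁ does not occur in μ. Hence μ occurs in
-- det M with coefficient ±ε ≢ 0 (mod p), so μ has every property shared by all monomials
-- of det M:
--   * c_k is homogeneous of degree re − k, hence so is det M; comparing with
--     deg μ = g·r(r−1)/2 gives the formula for g;
--   * if re < d(p−1), every entry of the last row vanishes;
--   * if p ≤ e, every monomial of f^e has degree at least e in x and x₁ together, so the
--     first-row entries c_k (k < p) are divisible by x₁, and then so is det M.
-- Finally det M is symmetric in x₁ and x₂, whereas exchanging them multiplies δ^g by (−1)^g;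
-- comparing the coefficients of μ and of μ with x₁, x₂ exchanged gives 2ε ≡ 0 for odd g,
-- that is, p = 2.

module Submission where

open import Data.Nat as ℕ using (ℕ; zero; suc; _+_; _*_; _∸_; _≤_; _<_; z≤n; s≤s)
open import Data.Nat.Primality using (Prime; euclidsLemma; prime⇒nonTrivial)

open import Data.Bool using (true; false; if_then_else_; T)
open import Data.Empty using (⊥-elim)
open import Data.Fin as Fin using (Fin; toℕ; punchIn)
import Data.Fin.Properties as FinP
open import Data.Integer as ℤ using (ℤ; +_)
open import Data.Integer.Divisibility.Signed
  using (_∣_; divides; ∣m∣n⇒∣m+n; ∣m⇒∣-m; ∣n⇒∣m*n; ∣m⇒∣m*n; ∣⇒∣ᵤ; ∣ᵤ⇒∣)
import Data.Integer.Properties as ℤP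
import Data.Integer.Tactic.RingSolver as ℤ-Solver
open import Data.List as List using (List; []; _∷_; _++_)
import Data.List.Properties as ListP
open import Data.List.Relation.Unary.All as All using (All; []; _∷_)
import Data.List.Relation.Unary.All.Properties as AllP
import Data.Nat.Divisibility as ℕD
import Data.Nat.Properties as ℕP
import Data.Nat.Tactic.RingSolver as ℕ-Solver
open import Data.Product using (_,_; proj₂; ∃)
open import Data.Sum using (_⊎_; inj₁; inj₂; [_,_]′)
open import Data.Unit using (⊤)
open import Data.Vec as Vec using (Vec; []; _∷_)
open import Data.Vec.Properties as VecP using (≡-dec)
open import Function using (_∘_; mk⇔)
open import Relation.Binary.PropositionalEquality
open import Relation.Nullary using (¬_; Dec; does; yes; no)
open import Relation.Nullary.Decidable using (dec-true; dec-false; does-⇔)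

open import Algebra.Properties.CommutativeSemigroup ℕP.+-commutativeSemigroup
  using () renaming (interchange to +-interchange)
open import Algebra.Properties.CommutativeSemigroup ℤP.*-commutativeSemigroup
  using () renaming (interchange to *-interchange)
open import Algebra.Properties.Semiring.Sum ℕP.+-*-semiring
  using (sum; sum-remove; sum-cong-≗; ∑-distrib-+; *-distribʳ-sum)

open import Defs

private variable k n r : ℕ

infixl 6 _⊕_ _⊖_

_⊕_ : Vec ℕ n → Vec ℕ n → Vec ℕ n
_⊕_ = Vec.zipWith _+_

_⊖_ : Vec ℕ n → Vec ℕ n → Vec ℕ n
_⊖_ = Vec.zipWith _∸_

zeros : Vec ℕ n
zeros = Vec.replicate _ 0

⊕-comm : (a b : Vec ℕ n) → a ⊕ b ≡ b ⊕ a
⊕-comm = VecP.zipWith-comm ℕP.+-comm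

⊕-assoc : (a b c : Vec ℕ n) → (a ⊕ b) ⊕ c ≡ a ⊕ (b ⊕ c)
⊕-assoc = VecP.zipWith-assoc ℕP.+-assoc

⊕-identityˡ : (a : Vec ℕ n) → zeros ⊕ a ≡ a
⊕-identityˡ = VecP.zipWith-identityˡ ℕP.+-identityˡ

⊕-⊖-cancelˡ : (a b : Vec ℕ n) → (a ⊕ b) ⊖ a ≡ b
⊕-⊖-cancelˡ [] [] = refl
⊕-⊖-cancelˡ (x ∷ a) (y ∷ b) = cong₂ _∷_ (ℕP.m+n∸m≡n x y) (⊕-⊖-cancelˡ a b)

infix 4 _≡_[mod_]

-- Records rather than plain divisibility statements, so that both sides can be inferred
-- from a proof; _≃_[mod_] below plays the same role for Defs' _≈[_]_.
record _≡_[mod_] (x y : ℤ) (p : ℕ) : Set where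
  constructor mod-intro
  field divides-difference : + p ∣ x ℤ.- y

open _≡_[mod_] public

module _ {p : ℕ} where

  private
    transport : ∀ {x y} → x ≡ y → + p ∣ x → + p ∣ y
    transport = subst (+ p ∣_)

  mod-reflexive : ∀ {x y} → x ≡ y → x ≡ y [mod p ]
  mod-reflexive {x} refl = mod-intro (transport (sym (ℤP.+-inverseʳ x)) (divides (+ 0) refl))

  mod-refl : ∀ {x} → x ≡ x [mod p ]
  mod-refl = mod-reflexive refl

  mod-sym : ∀ {x y} → x ≡ y [mod p ] → y ≡ x [mod p ]
  mod-sym {x} {y} (mod-intro h) = mod-intro (transport (difference-antisym x y) (∣m⇒∣-m h))
    where
    difference-antisym : ∀ x y → ℤ.- (x ℤ.- y) ≡ y ℤ.- x
    difference-antisym = ℤ-Solver.solve-∀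

  mod-trans : ∀ {x y z} → x ≡ y [mod p ] → y ≡ z [mod p ] → x ≡ z [mod p ]
  mod-trans {x} {y} {z} (mod-intro h) (mod-intro h′) = mod-intro (transport (telescope x y z) (∣m∣n⇒∣m+n h h′))
    where
    telescope : ∀ x y z → (x ℤ.- y) ℤ.+ (y ℤ.- z) ≡ x ℤ.- z
    telescope = ℤ-Solver.solve-∀

  +-mod : ∀ {x x′ y y′} → x ≡ x′ [mod p ] → y ≡ y′ [mod p ] → x ℤ.+ y ≡ x′ ℤ.+ y′ [mod p ]
  +-mod {x} {x′} {y} {y′} (mod-intro h) (mod-intro h′) =
    mod-intro (transport (regroup x x′ y y′) (∣m∣n⇒∣m+n h h′))
    where
    regroup : ∀ x x′ y y′ → (x ℤ.- x′) ℤ.+ (y ℤ.- y′) ≡ (x ℤ.+ y) ℤ.- (x′ ℤ.+ y′)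
    regroup = ℤ-Solver.solve-∀

  *-modʳ : ∀ c {x y} → x ≡ y [mod p ] → c ℤ.* x ≡ c ℤ.* y [mod p ]
  *-modʳ c {x} {y} (mod-intro h) = mod-intro (transport (distrib c x y) (∣n⇒∣m*n c h))
    where
    distrib : ∀ c x y → c ℤ.* (x ℤ.- y) ≡ c ℤ.* x ℤ.- c ℤ.* y
    distrib = ℤ-Solver.solve-∀

  -x≡x⇒∣2x : ∀ {x} → ℤ.- x ≡ x [mod p ] → + p ∣ + 2 ℤ.* x
  -x≡x⇒∣2x {x} (mod-intro h) = transport (double x) (∣m⇒∣-m h)
    where
    double : ∀ x → ℤ.- (ℤ.- x ℤ.- x) ≡ + 2 ℤ.* x
    double = ℤ-Solver.solve-∀

infix 4 _≟ᵉ_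

_≟ᵉ_ : (a b : Vec ℕ n) → Dec (a ≡ b)
_≟ᵉ_ = ≡-dec ℕ._≟_

indicator : Vec ℕ n → Vec ℕ n → ℤ
indicator m a = if does (a ≟ᵉ m) then + 1 else + 0

-- Through coeff P m ≡ linExt (indicator m) P, coefficients of products become double sums
-- (linExt-*ₚ); this is how congruence modulo p is carried through _*ₚ_.
linExt : (Vec ℕ n → ℤ) → Poly n → ℤ
linExt w [] = + 0
linExt w ((c , a) ∷ P) = c ℤ.* w a ℤ.+ linExt w P

monomial : ℤ → Vec ℕ n → Poly n
monomial c a = (c , a) ∷ []

coeff≡linExt-indicator : (P : Poly n) (m : Vec ℕ n) → coeff P m ≡ linExt (indicator m) P
coeff≡linExt-indicator [] m = refl
coeff≡linExt-indicator ((c , a) ∷ P) m with does (a ≟ᵉ m)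
... | true = cong₂ ℤ._+_ (sym (ℤP.*-identityʳ c)) (coeff≡linExt-indicator P m)
... | false = begin
  coeff P m                                  ≡⟨ coeff≡linExt-indicator P m ⟩
  linExt (indicator m) P                     ≡⟨ ℤP.+-identityˡ _ ⟨
  + 0 ℤ.+ linExt (indicator m) P             ≡⟨ cong (ℤ._+ linExt (indicator m) P) (ℤP.*-zeroʳ c) ⟨
  c ℤ.* + 0 ℤ.+ linExt (indicator m) P       ∎
  where open ≡-Reasoning

linExt-cong : {w w′ : Vec ℕ n → ℤ} → (∀ a → w a ≡ w′ a) → ∀ P → linExt w P ≡ linExt w′ P
linExt-cong w≗w′ [] = refl
linExt-cong w≗w′ ((c , a) ∷ P) = cong₂ (λ u v → c ℤ.* u ℤ.+ v) (w≗w′ a) (linExt-cong w≗w′ P)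

linExt-mod : ∀ {p} {w w′ : Vec ℕ n → ℤ} → (∀ a → w a ≡ w′ a [mod p ]) →
  ∀ P → linExt w P ≡ linExt w′ P [mod p ]
linExt-mod w≡w′ [] = mod-refl
linExt-mod w≡w′ ((c , a) ∷ P) = +-mod (*-modʳ c (w≡w′ a)) (linExt-mod w≡w′ P)

linExt-++ : (w : Vec ℕ n → ℤ) (P Q : Poly n) → linExt w (P ++ Q) ≡ linExt w P ℤ.+ linExt w Q
linExt-++ w [] Q = sym (ℤP.+-identityˡ _)
linExt-++ w ((c , a) ∷ P) Q =
  trans (cong (ℤ._+_ (c ℤ.* w a)) (linExt-++ w P Q)) (sym (ℤP.+-assoc (c ℤ.* w a) (linExt w P) (linExt w Q)))

linExt-zero : (Q : Poly n) → linExt (λ _ → + 0) Q ≡ + 0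
linExt-zero [] = refl
linExt-zero ((c , b) ∷ Q) =
  trans (cong (ℤ._+ linExt (λ _ → + 0) Q) (ℤP.*-zeroʳ c)) (trans (ℤP.+-identityˡ _) (linExt-zero Q))

linExt-linear : ∀ c (u v : Vec ℕ n → ℤ) Q →
  linExt (λ b → c ℤ.* u b ℤ.+ v b) Q ≡ c ℤ.* linExt u Q ℤ.+ linExt v Q
linExt-linear c u v [] = sym (cong (ℤ._+ + 0) (ℤP.*-zeroʳ c))
linExt-linear c u v ((c′ , b) ∷ Q) =
  trans (cong (ℤ._+_ (c′ ℤ.* (c ℤ.* u b ℤ.+ v b))) (linExt-linear c u v Q))
        (expand c c′ (u b) (v b) (linExt u Q) (linExt v Q))
  where
  expand : ∀ c c′ x y X Y →
    c′ ℤ.* (c ℤ.* x ℤ.+ y) ℤ.+ (c ℤ.* X ℤ.+ Y) ≡ c ℤ.* (c′ ℤ.* x ℤ.+ X) ℤ.+ (c′ ℤ.* y ℤ.+ Y)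
  expand = ℤ-Solver.solve-∀

linExt-exchange : (F : Vec ℕ n → Vec ℕ n → ℤ) (P Q : Poly n) →
  linExt (λ a → linExt (F a) Q) P ≡ linExt (λ b → linExt (λ a → F a b) P) Q
linExt-exchange F [] Q = sym (linExt-zero Q)
linExt-exchange F ((c , a) ∷ P) Q =
  trans (cong (ℤ._+_ (c ℤ.* linExt (F a) Q)) (linExt-exchange F P Q))
        (sym (linExt-linear c (F a) (λ b → linExt (λ a′ → F a′ b) P) Q))

*ₚ-∷ˡ : ∀ c a (P Q : Poly n) → ((c , a) ∷ P) *ₚ Q ≡ monomial c a *ₚ Q ++ P *ₚ Q
*ₚ-∷ˡ c a P Q = sym (ListP.++-assoc _ [] (P *ₚ Q))

linExt-monomial-*ₚ : (w : Vec ℕ n → ℤ) → ∀ c a Q →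
  linExt w (monomial c a *ₚ Q) ≡ c ℤ.* linExt (w ∘ (a ⊕_)) Q
linExt-monomial-*ₚ w c a [] = sym (ℤP.*-zeroʳ c)
linExt-monomial-*ₚ w c a ((c′ , b) ∷ Q) =
  trans (cong (ℤ._+_ ((c ℤ.* c′) ℤ.* w (a ⊕ b))) (linExt-monomial-*ₚ w c a Q)) (factor c c′ (w (a ⊕ b)) _)
  where
  factor : ∀ c c′ x L → (c ℤ.* c′) ℤ.* x ℤ.+ c ℤ.* L ≡ c ℤ.* (c′ ℤ.* x ℤ.+ L)
  factor = ℤ-Solver.solve-∀

linExt-*ₚ : (w : Vec ℕ n → ℤ) (P Q : Poly n) →
  linExt w (P *ₚ Q) ≡ linExt (λ a → linExt (w ∘ (a ⊕_)) Q) P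
linExt-*ₚ w [] Q = refl
linExt-*ₚ w ((c , a) ∷ P) Q = begin
  linExt w (((c , a) ∷ P) *ₚ Q)
    ≡⟨ cong (linExt w) (*ₚ-∷ˡ c a P Q) ⟩
  linExt w (monomial c a *ₚ Q ++ P *ₚ Q)
    ≡⟨ linExt-++ w (monomial c a *ₚ Q) (P *ₚ Q) ⟩
  linExt w (monomial c a *ₚ Q) ℤ.+ linExt w (P *ₚ Q)
    ≡⟨ cong₂ ℤ._+_ (linExt-monomial-*ₚ w c a Q) (linExt-*ₚ w P Q) ⟩
  linExt (λ a → linExt (w ∘ (a ⊕_)) Q) ((c , a) ∷ P) ∎
  where open ≡-Reasoning

coeff-*ₚ : (P Q : Poly n) (m : Vec ℕ n) →
  coeff (P *ₚ Q) m ≡ linExt (λ a → linExt (indicator m ∘ (a ⊕_)) Q) P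
coeff-*ₚ P Q m = trans (coeff≡linExt-indicator (P *ₚ Q) m) (linExt-*ₚ (indicator m) P Q)

coeff-*ₚ′ : (P Q : Poly n) (m : Vec ℕ n) →
  coeff (P *ₚ Q) m ≡ linExt (λ b → linExt (indicator m ∘ (b ⊕_)) P) Q
coeff-*ₚ′ P Q m = begin
  coeff (P *ₚ Q) m
    ≡⟨ coeff-*ₚ P Q m ⟩
  linExt (λ a → linExt (λ b → indicator m (a ⊕ b)) Q) P
    ≡⟨ linExt-exchange (λ a b → indicator m (a ⊕ b)) P Q ⟩
  linExt (λ b → linExt (λ a → indicator m (a ⊕ b)) P) Q
    ≡⟨ linExt-cong (λ b → linExt-cong (λ a → cong (indicator m) (⊕-comm a b)) P) Q ⟩
  linExt (λ b → linExt (λ a → indicator m (b ⊕ a)) P) Q ∎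
  where open ≡-Reasoning

coeff-++ : (P Q : Poly n) (m : Vec ℕ n) → coeff (P ++ Q) m ≡ coeff P m ℤ.+ coeff Q m
coeff-++ P Q m = begin
  coeff (P ++ Q) m
    ≡⟨ coeff≡linExt-indicator (P ++ Q) m ⟩
  linExt (indicator m) (P ++ Q)
    ≡⟨ linExt-++ (indicator m) P Q ⟩
  linExt (indicator m) P ℤ.+ linExt (indicator m) Q
    ≡⟨ cong₂ ℤ._+_ (coeff≡linExt-indicator P m) (coeff≡linExt-indicator Q m) ⟨
  coeff P m ℤ.+ coeff Q m ∎
  where open ≡-Reasoning

coeff-constₚ-*ₚ : ∀ c (P : Poly n) (m : Vec ℕ n) → coeff (constₚ c *ₚ P) m ≡ c ℤ.* coeff P m
coeff-constₚ-*ₚ c P m = begin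
  coeff (constₚ c *ₚ P) m
    ≡⟨ coeff-*ₚ (constₚ c) P m ⟩
  c ℤ.* linExt (indicator m ∘ (zeros ⊕_)) P ℤ.+ + 0
    ≡⟨ ℤP.+-identityʳ _ ⟩
  c ℤ.* linExt (indicator m ∘ (zeros ⊕_)) P
    ≡⟨ cong (c ℤ.*_) (linExt-cong (cong (indicator m) ∘ ⊕-identityˡ) P) ⟩
  c ℤ.* linExt (indicator m) P
    ≡⟨ cong (c ℤ.*_) (coeff≡linExt-indicator P m) ⟨
  c ℤ.* coeff P m ∎
  where open ≡-Reasoning

coeff-coeffX : ∀ {r} k (P : Poly (suc r)) (m : Vec ℕ r) → coeff (coeffX k P) m ≡ coeff P (k ∷ m)
coeff-coeffX k [] m = refl
coeff-coeffX k ((c , (a ∷ as)) ∷ P) m with a ℕ.≡ᵇ k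
... | true = cong (λ z → if does (as ≟ᵉ m) then c ℤ.+ z else z) (coeff-coeffX k P m)
... | false = coeff-coeffX k P m

indicator-shift : (a m : Vec ℕ n) →
  (∀ b → indicator m (a ⊕ b) ≡ indicator (m ⊖ a) b) ⊎ (∀ b → indicator m (a ⊕ b) ≡ + 0)
indicator-shift a m with a ⊕ (m ⊖ a) ≟ᵉ m
... | yes a⊕[m⊖a]≡m = inj₁ λ b → cong (λ t → if t then + 1 else + 0) (does-⇔ (mk⇔
        (λ a⊕b≡m → trans (sym (⊕-⊖-cancelˡ a b)) (cong (_⊖ a) a⊕b≡m))
        (λ b≡m⊖a → trans (cong (a ⊕_) b≡m⊖a) a⊕[m⊖a]≡m)) (a ⊕ b ≟ᵉ m) (b ≟ᵉ m ⊖ a))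
... | no a⊕[m⊖a]≢m = inj₂ λ b → cong (λ t → if t then + 1 else + 0) (dec-false (a ⊕ b ≟ᵉ m)
        λ a⊕b≡m → a⊕[m⊖a]≢m (trans (cong (λ z → a ⊕ (z ⊖ a)) (sym a⊕b≡m))
                                  (trans (cong (a ⊕_) (⊕-⊖-cancelˡ a b)) a⊕b≡m)))

sumFin-ext : {F G : Fin k → Poly n} → (∀ i → F i ≡ G i) → sumFin F ≡ sumFin G
sumFin-ext {k = zero} F≗G = refl
sumFin-ext {k = suc k} F≗G = cong₂ _++_ (F≗G Fin.zero) (sumFin-ext (F≗G ∘ Fin.suc))

prodFin-ext : {F G : Fin k → Poly n} → (∀ i → F i ≡ G i) → prodFin F ≡ prodFin G
prodFin-ext {k = zero} F≗G = refl
prodFin-ext {k = suc k} F≗G = cong₂ _*ₚ_ (F≗G Fin.zero) (prodFin-ext (F≗G ∘ Fin.suc))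

cofactorSign : Fin k → ℤ
cofactorSign j = (ℤ.- (+ 1)) ℤ.^ toℕ j

minor : (Fin (suc k) → Fin (suc k) → Poly n) → Fin (suc k) → Fin k → Fin k → Poly n
minor M j a b = M (Fin.suc a) (punchIn j b)

laplace-term : (Fin (suc k) → Fin (suc k) → Poly n) → Fin (suc k) → Poly n
laplace-term M j = constₚ (cofactorSign j) *ₚ (M Fin.zero j *ₚ det (minor M j))

infix 4 _≃_[mod_]

record _≃_[mod_] (P Q : Poly n) (p : ℕ) : Set where
  constructor coeffwise
  field coeff-mod : ∀ m → coeff P m ≡ coeff Q m [mod p ]

open _≃_[mod_] public

module _ {p : ℕ} where

  ≃-reflexive : {P Q : Poly n} → P ≡ Q → P ≃ Q [mod p ]
  ≃-reflexive refl = coeffwise λ _ → mod-refl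

  ≃-refl : {P : Poly n} → P ≃ P [mod p ]
  ≃-refl = ≃-reflexive refl

  ≈⇒≃ : {P Q : Poly n} → P ≈[ p ] Q → P ≃ Q [mod p ]
  ≈⇒≃ P≈Q = coeffwise λ m → mod-intro (∣ᵤ⇒∣ (P≈Q m))

  ≃-trans : {P Q R : Poly n} → P ≃ Q [mod p ] → Q ≃ R [mod p ] → P ≃ R [mod p ]
  ≃-trans P≃Q Q≃R = coeffwise λ m → mod-trans (coeff-mod P≃Q m) (coeff-mod Q≃R m)

  linExt-shift-mod : {Q Q′ : Poly n} → Q ≃ Q′ [mod p ] → ∀ a m →
    linExt (indicator m ∘ (a ⊕_)) Q ≡ linExt (indicator m ∘ (a ⊕_)) Q′ [mod p ]
  linExt-shift-mod {Q = Q} {Q′} Q≃Q′ a m with indicator-shift a m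
  ... | inj₁ shift = mod-trans (mod-reflexive (as-coeff Q))
                       (mod-trans (coeff-mod Q≃Q′ (m ⊖ a)) (mod-reflexive (sym (as-coeff Q′))))
    where
    as-coeff : ∀ R → linExt (indicator m ∘ (a ⊕_)) R ≡ coeff R (m ⊖ a)
    as-coeff R = trans (linExt-cong shift R) (sym (coeff≡linExt-indicator R (m ⊖ a)))
  ... | inj₂ vanish = mod-reflexive (trans (vanishing Q) (sym (vanishing Q′)))
    where
    vanishing : ∀ R → linExt (indicator m ∘ (a ⊕_)) R ≡ + 0
    vanishing R = trans (linExt-cong vanish R) (linExt-zero R)

  *ₚ-congˡ : (P : Poly n) {Q Q′ : Poly n} → Q ≃ Q′ [mod p ] → P *ₚ Q ≃ P *ₚ Q′ [mod p ]
  *ₚ-congˡ P {Q} {Q′} Q≃Q′ = coeffwise λ m →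
    mod-trans (mod-reflexive (coeff-*ₚ P Q m))
      (mod-trans (linExt-mod (λ a → linExt-shift-mod Q≃Q′ a m) P) (mod-reflexive (sym (coeff-*ₚ P Q′ m))))

  *ₚ-congʳ : {P P′ : Poly n} (Q : Poly n) → P ≃ P′ [mod p ] → P *ₚ Q ≃ P′ *ₚ Q [mod p ]
  *ₚ-congʳ {P = P} {P′} Q P≃P′ = coeffwise λ m →
    mod-trans (mod-reflexive (coeff-*ₚ′ P Q m))
      (mod-trans (linExt-mod (λ b → linExt-shift-mod P≃P′ b m) Q) (mod-reflexive (sym (coeff-*ₚ′ P′ Q m))))

  *ₚ-cong : {P P′ Q Q′ : Poly n} →
    P ≃ P′ [mod p ] → Q ≃ Q′ [mod p ] → P *ₚ Q ≃ P′ *ₚ Q′ [mod p ]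
  *ₚ-cong {P′ = P′} {Q} P≃P′ Q≃Q′ = ≃-trans (*ₚ-congʳ Q P≃P′) (*ₚ-congˡ P′ Q≃Q′)

  ++-cong : {P P′ Q Q′ : Poly n} → P ≃ P′ [mod p ] → Q ≃ Q′ [mod p ] → P ++ Q ≃ P′ ++ Q′ [mod p ]
  ++-cong {P = P} {P′} {Q} {Q′} P≃P′ Q≃Q′ = coeffwise λ m →
    mod-trans (mod-reflexive (coeff-++ P Q m))
      (mod-trans (+-mod (coeff-mod P≃P′ m) (coeff-mod Q≃Q′ m)) (mod-reflexive (sym (coeff-++ P′ Q′ m))))

  *ₚ-left-comm : (A B C : Poly n) → A *ₚ (B *ₚ C) ≃ B *ₚ (A *ₚ C) [mod p ]
  *ₚ-left-comm A B C = coeffwise λ m → mod-reflexive (begin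
    coeff (A *ₚ (B *ₚ C)) m
      ≡⟨ coeff-*ₚ A (B *ₚ C) m ⟩
    linExt (λ a → linExt (indicator m ∘ (a ⊕_)) (B *ₚ C)) A
      ≡⟨ linExt-cong (λ a → linExt-*ₚ (indicator m ∘ (a ⊕_)) B C) A ⟩
    linExt (λ a → linExt (λ b → linExt (λ c → indicator m (a ⊕ (b ⊕ c))) C) B) A
      ≡⟨ linExt-exchange (λ a b → linExt (λ c → indicator m (a ⊕ (b ⊕ c))) C) A B ⟩
    linExt (λ b → linExt (λ a → linExt (λ c → indicator m (a ⊕ (b ⊕ c))) C) A) B
      ≡⟨ linExt-cong (λ b → linExt-cong (λ a →
           linExt-cong (λ c → cong (indicator m) (⊕-left-comm a b c)) C) A) B ⟩
    linExt (λ b → linExt (λ a → linExt (λ c → indicator m (b ⊕ (a ⊕ c))) C) A) B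
      ≡⟨ linExt-cong (λ b → linExt-*ₚ (indicator m ∘ (b ⊕_)) A C) B ⟨
    linExt (λ b → linExt (indicator m ∘ (b ⊕_)) (A *ₚ C)) B
      ≡⟨ coeff-*ₚ B (A *ₚ C) m ⟨
    coeff (B *ₚ (A *ₚ C)) m ∎)
    where
    open ≡-Reasoning
    ⊕-left-comm : (a b c : Vec ℕ n) → a ⊕ (b ⊕ c) ≡ b ⊕ (a ⊕ c)
    ⊕-left-comm a b c = trans (sym (⊕-assoc a b c)) (trans (cong (_⊕ c) (⊕-comm a b)) (⊕-assoc b a c))

  sumFin-cong : ∀ {k} {F G : Fin k → Poly n} → (∀ i → F i ≃ G i [mod p ]) → sumFin F ≃ sumFin G [mod p ]
  sumFin-cong {k = zero} F≃G = ≃-refl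
  sumFin-cong {k = suc k} F≃G = ++-cong (F≃G Fin.zero) (sumFin-cong (F≃G ∘ Fin.suc))

  powₚ-cong : {P Q : Poly n} → P ≃ Q [mod p ] → ∀ e → powₚ P e ≃ powₚ Q e [mod p ]
  powₚ-cong P≃Q zero = ≃-refl
  powₚ-cong P≃Q (suc e) = *ₚ-cong P≃Q (powₚ-cong P≃Q e)

  det-cong : ∀ {k} {M M′ : Fin k → Fin k → Poly n} →
    (∀ i j → M i j ≃ M′ i j [mod p ]) → det M ≃ det M′ [mod p ]
  det-cong {k = zero} M≃M′ = ≃-refl
  det-cong {k = suc k} M≃M′ = sumFin-cong λ j →
    *ₚ-congˡ (constₚ (cofactorSign j))
      (*ₚ-cong (M≃M′ Fin.zero j) (det-cong λ a b → M≃M′ (Fin.suc a) (punchIn j b)))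

  coeffX-cong : ∀ {r} k {P Q : Poly (suc r)} → P ≃ Q [mod p ] → coeffX k P ≃ coeffX k Q [mod p ]
  coeffX-cong k {P} {Q} P≃Q = coeffwise λ m →
    mod-trans (mod-reflexive (coeff-coeffX k P m))
      (mod-trans (coeff-mod P≃Q (k ∷ m)) (mod-reflexive (sym (coeff-coeffX k Q m))))

mapExp : (Vec ℕ n → Vec ℕ n) → Poly n → Poly n
mapExp h = List.map λ (c , a) → (c , h a)

module _ (h : Vec ℕ n → Vec ℕ n) (h-⊕ : ∀ a b → h (a ⊕ b) ≡ h a ⊕ h b) (h-zeros : h zeros ≡ zeros) where

  mapExp-++ : (P Q : Poly n) → mapExp h (P ++ Q) ≡ mapExp h P ++ mapExp h Q
  mapExp-++ = ListP.map-++ _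

  mapExp-monomial-*ₚ : ∀ c a Q → mapExp h (monomial c a *ₚ Q) ≡ monomial c (h a) *ₚ mapExp h Q
  mapExp-monomial-*ₚ c a [] = refl
  mapExp-monomial-*ₚ c a ((c′ , b) ∷ Q) =
    cong₂ _∷_ (cong (c ℤ.* c′ ,_) (h-⊕ a b)) (mapExp-monomial-*ₚ c a Q)

  mapExp-*ₚ : (P Q : Poly n) → mapExp h (P *ₚ Q) ≡ mapExp h P *ₚ mapExp h Q
  mapExp-*ₚ [] Q = refl
  mapExp-*ₚ ((c , a) ∷ P) Q = begin
    mapExp h (((c , a) ∷ P) *ₚ Q)
      ≡⟨ cong (mapExp h) (*ₚ-∷ˡ c a P Q) ⟩
    mapExp h (monomial c a *ₚ Q ++ P *ₚ Q)
      ≡⟨ mapExp-++ (monomial c a *ₚ Q) (P *ₚ Q) ⟩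
    mapExp h (monomial c a *ₚ Q) ++ mapExp h (P *ₚ Q)
      ≡⟨ cong₂ _++_ (mapExp-monomial-*ₚ c a Q) (mapExp-*ₚ P Q) ⟩
    monomial c (h a) *ₚ mapExp h Q ++ mapExp h P *ₚ mapExp h Q
      ≡⟨ *ₚ-∷ˡ c (h a) (mapExp h P) (mapExp h Q) ⟨
    mapExp h ((c , a) ∷ P) *ₚ mapExp h Q ∎
    where open ≡-Reasoning

  mapExp-constₚ : ∀ c → mapExp h (constₚ c) ≡ constₚ c
  mapExp-constₚ c = cong (λ z → (c , z) ∷ []) h-zeros

  mapExp-powₚ : (P : Poly n) (e : ℕ) → mapExp h (powₚ P e) ≡ powₚ (mapExp h P) e
  mapExp-powₚ P zero = mapExp-constₚ (+ 1)
  mapExp-powₚ P (suc e) = trans (mapExp-*ₚ P (powₚ P e)) (cong (mapExp h P *ₚ_) (mapExp-powₚ P e))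

  mapExp-sumFin : (F : Fin k → Poly n) → mapExp h (sumFin F) ≡ sumFin (mapExp h ∘ F)
  mapExp-sumFin {k = zero} F = refl
  mapExp-sumFin {k = suc k} F =
    trans (mapExp-++ (F Fin.zero) _) (cong (mapExp h (F Fin.zero) ++_) (mapExp-sumFin (F ∘ Fin.suc)))

  mapExp-prodFin : (F : Fin k → Poly n) → mapExp h (prodFin F) ≡ prodFin (mapExp h ∘ F)
  mapExp-prodFin {k = zero} F = mapExp-constₚ (+ 1)
  mapExp-prodFin {k = suc k} F =
    trans (mapExp-*ₚ (F Fin.zero) _) (cong (mapExp h (F Fin.zero) *ₚ_) (mapExp-prodFin (F ∘ Fin.suc)))

  mapExp-det : (M : Fin k → Fin k → Poly n) → mapExp h (det M) ≡ det (λ i j → mapExp h (M i j))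
  mapExp-det {k = zero} M = mapExp-constₚ (+ 1)
  mapExp-det {k = suc k} M = trans (mapExp-sumFin (laplace-term M)) (sumFin-ext λ j → begin
    mapExp h (laplace-term M j)
      ≡⟨ mapExp-*ₚ (constₚ (cofactorSign j)) _ ⟩
    mapExp h (constₚ (cofactorSign j)) *ₚ mapExp h (M Fin.zero j *ₚ det (minor M j))
      ≡⟨ cong₂ _*ₚ_ (mapExp-constₚ (cofactorSign j)) (mapExp-*ₚ (M Fin.zero j) (det (minor M j))) ⟩
    constₚ (cofactorSign j) *ₚ (mapExp h (M Fin.zero j) *ₚ mapExp h (det (minor M j)))
      ≡⟨ cong (λ D → constₚ (cofactorSign j) *ₚ (mapExp h (M Fin.zero j) *ₚ D)) (mapExp-det (minor M j)) ⟩
    laplace-term (λ a b → mapExp h (M a b)) j ∎)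
    where open ≡-Reasoning

onTail : (Vec ℕ r → Vec ℕ r) → Vec ℕ (suc r) → Vec ℕ (suc r)
onTail h (a ∷ as) = a ∷ h as

coeffX-mapExp : (h : Vec ℕ r → Vec ℕ r) (k : ℕ) (P : Poly (suc r)) →
  coeffX k (mapExp (onTail h) P) ≡ mapExp h (coeffX k P)
coeffX-mapExp h k [] = refl
coeffX-mapExp h k ((c , (a ∷ as)) ∷ P) with a ℕ.≡ᵇ k
... | true = cong (_ ∷_) (coeffX-mapExp h k P)
... | false = coeffX-mapExp h k P

coeff-mapExp-involution : (h : Vec ℕ n → Vec ℕ n) → (∀ a → h (h a) ≡ a) →
  (P : Poly n) (m : Vec ℕ n) → coeff (mapExp h P) m ≡ coeff P (h m)
coeff-mapExp-involution h h∘h≗id [] m = refl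
coeff-mapExp-involution h h∘h≗id ((c , a) ∷ P) m
  rewrite does-⇔ (mk⇔ (λ ha≡m → trans (sym (h∘h≗id a)) (cong h ha≡m))
                      (λ a≡hm → trans (cong h a≡hm) (h∘h≗id m)))
                 (h a ≟ᵉ m) (a ≟ᵉ h m) =
  cong (λ z → if does (a ≟ᵉ h m) then c ℤ.+ z else z) (coeff-mapExp-involution h h∘h≗id P m)

AllTerms : (Vec ℕ n → Set) → Poly n → Set
AllTerms Q = All (Q ∘ proj₂)

allTerms-*ₚ : {Q₁ Q₂ Q₃ : Vec ℕ n → Set} → (∀ {a b} → Q₁ a → Q₂ b → Q₃ (a ⊕ b)) →
  {P Q : Poly n} → AllTerms Q₁ P → AllTerms Q₂ Q → AllTerms Q₃ (P *ₚ Q)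
allTerms-*ₚ closed allP allQ =
  AllP.concat⁺ (AllP.map⁺ (All.map (λ q₁ → AllP.map⁺ (All.map (closed q₁) allQ)) allP))

allTerms-sumFin : {Q : Vec ℕ n → Set} (F : Fin k → Poly n) → (∀ j → AllTerms Q (F j)) → AllTerms Q (sumFin F)
allTerms-sumFin {k = zero} F all = []
allTerms-sumFin {k = suc k} F all = AllP.++⁺ (all Fin.zero) (allTerms-sumFin (F ∘ Fin.suc) (all ∘ Fin.suc))

allTerms-⊤ : (P : Poly n) → AllTerms (λ _ → ⊤) P
allTerms-⊤ = All.universal _

allTerms-monomial : {Q : Vec ℕ n → Set} {P : Poly n} {c : ℤ} {m : Vec ℕ n} →
  AllTerms Q P → P ≡ monomial c m → Q m
allTerms-monomial (q ∷ []) refl = q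

coeff-vanishes : (P : Poly n) (m : Vec ℕ n) → AllTerms (_≢ m) P → coeff P m ≡ + 0
coeff-vanishes [] m [] = refl
coeff-vanishes ((c , a) ∷ P) m (a≢m ∷ rest) rewrite dec-false (a ≟ᵉ m) a≢m = coeff-vanishes P m rest

coeff≢0⇒satisfies : {Q : Vec ℕ n → Set} {P : Poly n} {m : Vec ℕ n} →
  Dec (Q m) → AllTerms Q P → coeff P m ≢ + 0 → Q m
coeff≢0⇒satisfies (yes q) _ _ = q
coeff≢0⇒satisfies {Q = Q} {P} {m} (no ¬q) all coeff≢0 =
  ⊥-elim (coeff≢0 (coeff-vanishes P m (All.map (λ q a≡m → ¬q (subst Q a≡m q)) all)))

degree : Vec ℕ n → ℕ
degree = Vec.sum

degree-⊕ : (a b : Vec ℕ n) → degree (a ⊕ b) ≡ degree a + degree b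
degree-⊕ [] [] = refl
degree-⊕ (x ∷ a) (y ∷ b) = trans (cong (_+_ (x + y)) (degree-⊕ a b)) (+-interchange x y (degree a) (degree b))

degree-zeros : ∀ n → degree (zeros {n}) ≡ 0
degree-zeros zero = refl
degree-zeros (suc n) = degree-zeros n

Homogeneous : ℕ → Poly n → Set
Homogeneous N = AllTerms (λ a → degree a ≡ N)

homogeneous-*ₚ : ∀ {N₁ N₂} {P Q : Poly n} →
  Homogeneous N₁ P → Homogeneous N₂ Q → Homogeneous (N₁ + N₂) (P *ₚ Q)
homogeneous-*ₚ = allTerms-*ₚ λ {a} {b} deg-a deg-b → trans (degree-⊕ a b) (cong₂ _+_ deg-a deg-b)

homogeneous-constₚ : ∀ c → Homogeneous 0 (constₚ {n} c)
homogeneous-constₚ {n} c = degree-zeros n ∷ []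

homogeneous-prodFin : (F : Fin k → Poly n) (N : Fin k → ℕ) →
  (∀ i → Homogeneous (N i) (F i)) → Homogeneous (sum N) (prodFin F)
homogeneous-prodFin {k = zero} F N hom = homogeneous-constₚ (+ 1)
homogeneous-prodFin {k = suc k} F N hom =
  homogeneous-*ₚ (hom Fin.zero) (homogeneous-prodFin (F ∘ Fin.suc) (N ∘ Fin.suc) (hom ∘ Fin.suc))

homogeneous-powₚ : ∀ {N} {P : Poly n} → Homogeneous N P → ∀ e → Homogeneous (e * N) (powₚ P e)
homogeneous-powₚ hom zero = homogeneous-constₚ (+ 1)
homogeneous-powₚ hom (suc e) = homogeneous-*ₚ hom (homogeneous-powₚ hom e)

det-homogeneous : (M : Fin k → Fin k → Poly n) (R C : Fin k → ℕ) (K : ℕ) →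
  (∀ i j → AllTerms (λ a → degree a + (R i + C j) ≡ K) (M i j)) →
  AllTerms (λ a → degree a + (sum R + sum C) ≡ k * K) (det M)
det-homogeneous {k = zero} {n} M R C K hom = cong (_+ 0) (degree-zeros n) ∷ []
det-homogeneous {k = suc k} {n} M R C K hom = allTerms-sumFin (laplace-term M) λ j →
  allTerms-*ₚ (λ {a} {b} → absorb-sign {a} {b}) (homogeneous-constₚ (cofactorSign j))
    (allTerms-*ₚ (λ {a} {b} → expand j {a} {b}) (hom Fin.zero j)
      (det-homogeneous (minor M j) (R ∘ Fin.suc) (C ∘ punchIn j) K (λ a b → hom (Fin.suc a) (punchIn j b))))
  where
  absorb-sign : ∀ {a b : Vec ℕ n} {N} →
    degree a ≡ 0 → degree b + N ≡ suc k * K → degree (a ⊕ b) + N ≡ suc k * K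
  absorb-sign {a} {b} deg-a deg-b = trans (cong (_+ _) (trans (degree-⊕ a b) (cong (_+ degree b) deg-a))) deg-b
  expand : ∀ j {a b : Vec ℕ n} → degree a + (R Fin.zero + C j) ≡ K →
    degree b + (sum (R ∘ Fin.suc) + sum (C ∘ punchIn j)) ≡ k * K →
    degree (a ⊕ b) + (sum R + sum C) ≡ suc k * K
  expand j {a} {b} deg-a deg-b = begin
    degree (a ⊕ b) + (sum R + sum C)
      ≡⟨ cong₂ (λ x y → x + (sum R + y)) (degree-⊕ a b) (sum-remove {i = j} C) ⟩
    degree a + degree b + (R Fin.zero + sum (R ∘ Fin.suc) + (C j + sum (C ∘ punchIn j)))
      ≡⟨ regroup (degree a) (degree b) (R Fin.zero) (sum (R ∘ Fin.suc)) (C j) (sum (C ∘ punchIn j)) ⟩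
    (degree a + (R Fin.zero + C j)) + (degree b + (sum (R ∘ Fin.suc) + sum (C ∘ punchIn j)))
      ≡⟨ cong₂ _+_ deg-a deg-b ⟩
    K + k * K ∎
    where
    open ≡-Reasoning
    regroup : ∀ x y r rs c cs → x + y + (r + rs + (c + cs)) ≡ (x + (r + c)) + (y + (rs + cs))
    regroup = ℕ-Solver.solve-∀

module _ (I : Vec ℕ n → Set) (I-⊕ˡ : ∀ a b → I a → I (a ⊕ b)) (I-⊕ʳ : ∀ a b → I b → I (a ⊕ b))
  where

  private
    absorbˡ : ∀ {a b} → ⊤ → I b → I (a ⊕ b)
    absorbˡ {a} {b} _ = I-⊕ʳ a b

    absorbʳ : ∀ {a b} → I a → ⊤ → I (a ⊕ b)
    absorbʳ {a} {b} Ia _ = I-⊕ˡ a b Ia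

  det-row-in-ideal : (M : Fin k → Fin k → Poly n) (i : Fin k) → (∀ j → AllTerms I (M i j)) → AllTerms I (det M)
  det-row-in-ideal M Fin.zero row-in-I = allTerms-sumFin (laplace-term M) λ j →
    allTerms-*ₚ absorbˡ (allTerms-⊤ (constₚ (cofactorSign j)))
      (allTerms-*ₚ absorbʳ (row-in-I j) (allTerms-⊤ (det (minor M j))))
  det-row-in-ideal M (Fin.suc i) row-in-I = allTerms-sumFin (laplace-term M) λ j →
    allTerms-*ₚ absorbˡ (allTerms-⊤ (constₚ (cofactorSign j)))
      (allTerms-*ₚ absorbˡ (allTerms-⊤ (M Fin.zero j)) (det-row-in-ideal (minor M j) i (row-in-I ∘ punchIn j)))

-- Leading forms for the weight Σ i·aᵢ

weight : Vec ℕ n → ℕ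
weight [] = 0
weight (x ∷ xs) = weight xs + degree xs

weight-⊕ : (a b : Vec ℕ n) → weight (a ⊕ b) ≡ weight a + weight b
weight-⊕ [] [] = refl
weight-⊕ (x ∷ a) (y ∷ b) rewrite weight-⊕ a b | degree-⊕ a b =
  +-interchange (weight a) (weight b) (degree a) (degree b)

weight-zeros : ∀ n → weight (zeros {n}) ≡ 0
weight-zeros zero = refl
weight-zeros (suc n) rewrite weight-zeros n | degree-zeros n = refl

Bounded : ℕ → Poly n → Set
Bounded N = AllTerms (λ a → weight a ≤ N)

bounded-*ₚ : ∀ {N₁ N₂} {P Q : Poly n} → Bounded N₁ P → Bounded N₂ Q → Bounded (N₁ + N₂) (P *ₚ Q)
bounded-*ₚ = allTerms-*ₚ λ {a} {b} wa wb → subst (_≤ _) (sym (weight-⊕ a b)) (ℕP.+-mono-≤ wa wb)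

bounded-constₚ : ∀ c → Bounded 0 (constₚ {n} c)
bounded-constₚ {n} c = ℕP.≤-reflexive (weight-zeros n) ∷ []

bounded-prodFin : (F : Fin k → Poly n) (N : Fin k → ℕ) →
  (∀ i → Bounded (N i) (F i)) → Bounded (sum N) (prodFin F)
bounded-prodFin {k = zero} F N bnd = bounded-constₚ (+ 1)
bounded-prodFin {k = suc k} F N bnd =
  bounded-*ₚ (bnd Fin.zero) (bounded-prodFin (F ∘ Fin.suc) (N ∘ Fin.suc) (bnd ∘ Fin.suc))

bounded-powₚ : ∀ {N} {P : Poly n} → Bounded N P → ∀ e → Bounded (e * N) (powₚ P e)
bounded-powₚ bnd zero = bounded-constₚ (+ 1)
bounded-powₚ bnd (suc e) = bounded-*ₚ bnd (bounded-powₚ bnd e)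

hasWeight? : (N : ℕ) (t : Term n) → Dec (weight (proj₂ t) ≡ N)
hasWeight? N (_ , a) = weight a ℕ.≟ N

leading : ℕ → Poly n → Poly n
leading N = List.filter (hasWeight? N)

leading-accept : ∀ {N} c (a : Vec ℕ n) P → weight a ≡ N → leading N ((c , a) ∷ P) ≡ (c , a) ∷ leading N P
leading-accept c a P = ListP.filter-accept (hasWeight? _) {x = c , a} {xs = P}

leading-reject : ∀ {N} c (a : Vec ℕ n) P → weight a ≢ N → leading N ((c , a) ∷ P) ≡ leading N P
leading-reject c a P = ListP.filter-reject (hasWeight? _) {x = c , a} {xs = P}

leading-pair-fst : ∀ {N} c (a : Vec ℕ n) c′ b → weight a ≡ N → weight b ≢ N →
  leading N ((c , a) ∷ (c′ , b) ∷ []) ≡ monomial c a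
leading-pair-fst c a c′ b wa wb≢ = trans (leading-accept c a _ wa) (cong (_ ∷_) (leading-reject c′ b [] wb≢))

leading-pair-snd : ∀ {N} c (a : Vec ℕ n) c′ b → weight a ≢ N → weight b ≡ N →
  leading N ((c , a) ∷ (c′ , b) ∷ []) ≡ monomial c′ b
leading-pair-snd c a c′ b wa≢ wb = trans (leading-reject c a _ wa≢) (leading-accept c′ b [] wb)

leading-monomial-*ₚ : ∀ {N₁} N₂ c {a : Vec ℕ n} → weight a ≡ N₁ → (Q : Poly n) →
  leading (N₁ + N₂) (monomial c a *ₚ Q) ≡ monomial c a *ₚ leading N₂ Q
leading-monomial-*ₚ N₂ c wa [] = refl
leading-monomial-*ₚ {N₁ = N₁} N₂ c {a} wa ((c′ , b) ∷ Q) with weight b ℕ.≟ N₂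
... | yes wb = begin
  leading (N₁ + N₂) ((c ℤ.* c′ , a ⊕ b) ∷ monomial c a *ₚ Q)
    ≡⟨ leading-accept (c ℤ.* c′) (a ⊕ b) (monomial c a *ₚ Q) (trans (weight-⊕ a b) (cong₂ _+_ wa wb)) ⟩
  (c ℤ.* c′ , a ⊕ b) ∷ leading (N₁ + N₂) (monomial c a *ₚ Q)
    ≡⟨ cong (_ ∷_) (leading-monomial-*ₚ N₂ c wa Q) ⟩
  monomial c a *ₚ ((c′ , b) ∷ leading N₂ Q)
    ≡⟨ cong (monomial c a *ₚ_) (leading-accept c′ b Q wb) ⟨
  monomial c a *ₚ leading N₂ ((c′ , b) ∷ Q) ∎
  where open ≡-Reasoning
... | no wb≢ = begin
  leading (N₁ + N₂) ((c ℤ.* c′ , a ⊕ b) ∷ monomial c a *ₚ Q)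
    ≡⟨ leading-reject (c ℤ.* c′) (a ⊕ b) (monomial c a *ₚ Q)
         (λ w≡ → wb≢ (ℕP.+-cancelˡ-≡ N₁ _ _
                      (trans (cong (_+ weight b) (sym wa)) (trans (sym (weight-⊕ a b)) w≡)))) ⟩
  leading (N₁ + N₂) (monomial c a *ₚ Q)
    ≡⟨ leading-monomial-*ₚ N₂ c wa Q ⟩
  monomial c a *ₚ leading N₂ Q
    ≡⟨ cong (monomial c a *ₚ_) (leading-reject c′ b Q wb≢) ⟨
  monomial c a *ₚ leading N₂ ((c′ , b) ∷ Q) ∎
  where open ≡-Reasoning

leading-*ₚ : ∀ {N₁ N₂} (P Q : Poly n) → Bounded N₁ P → Bounded N₂ Q →
  leading (N₁ + N₂) (P *ₚ Q) ≡ leading N₁ P *ₚ leading N₂ Q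
leading-*ₚ [] Q bP bQ = refl
leading-*ₚ {n = n} {N₁ = N₁} {N₂} ((c , a) ∷ P) Q (wa≤ ∷ bP) bQ = begin
  leading (N₁ + N₂) (((c , a) ∷ P) *ₚ Q)
    ≡⟨ cong (leading (N₁ + N₂)) (*ₚ-∷ˡ c a P Q) ⟩
  leading (N₁ + N₂) (monomial c a *ₚ Q ++ P *ₚ Q)
    ≡⟨ ListP.filter-++ (hasWeight? (N₁ + N₂)) (monomial c a *ₚ Q) (P *ₚ Q) ⟩
  leading (N₁ + N₂) (monomial c a *ₚ Q) ++ leading (N₁ + N₂) (P *ₚ Q)
    ≡⟨ cong₂ _++_ refl (leading-*ₚ P Q bP bQ) ⟩
  leading (N₁ + N₂) (monomial c a *ₚ Q) ++ leading N₁ P *ₚ leading N₂ Q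
    ≡⟨ head-term (weight a ℕ.≟ N₁) ⟩
  leading N₁ ((c , a) ∷ P) *ₚ leading N₂ Q ∎
  where
  open ≡-Reasoning
  head-term : Dec (weight a ≡ N₁) →
    leading (N₁ + N₂) (monomial c a *ₚ Q) ++ leading N₁ P *ₚ leading N₂ Q ≡
    leading N₁ ((c , a) ∷ P) *ₚ leading N₂ Q
  head-term (yes wa) = begin
    leading (N₁ + N₂) (monomial c a *ₚ Q) ++ leading N₁ P *ₚ leading N₂ Q
      ≡⟨ cong (_++ _) (leading-monomial-*ₚ N₂ c wa Q) ⟩
    monomial c a *ₚ leading N₂ Q ++ leading N₁ P *ₚ leading N₂ Q
      ≡⟨ *ₚ-∷ˡ c a (leading N₁ P) (leading N₂ Q) ⟨
    ((c , a) ∷ leading N₁ P) *ₚ leading N₂ Q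
      ≡⟨ cong (_*ₚ leading N₂ Q) (leading-accept c a P wa) ⟨
    leading N₁ ((c , a) ∷ P) *ₚ leading N₂ Q ∎
  head-term (no wa≢) = begin
    leading (N₁ + N₂) (monomial c a *ₚ Q) ++ leading N₁ P *ₚ leading N₂ Q
      ≡⟨ cong (_++ _) (ListP.filter-none (hasWeight? (N₁ + N₂)) {xs = monomial c a *ₚ Q}
           (allTerms-*ₚ (λ {a} {b} → too-light {a} {b}) {P = monomial c a} (wa< ∷ []) bQ)) ⟩
    leading N₁ P *ₚ leading N₂ Q
      ≡⟨ cong (_*ₚ leading N₂ Q) (leading-reject c a P wa≢) ⟨
    leading N₁ ((c , a) ∷ P) *ₚ leading N₂ Q ∎
    where
    wa< : weight a < N₁
    wa< = ℕP.≤∧≢⇒< wa≤ wa≢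
    too-light : ∀ {a b : Vec ℕ n} → weight a < N₁ → weight b ≤ N₂ → weight (a ⊕ b) ≢ N₁ + N₂
    too-light {a} {b} wa< wb≤ w≡ = ℕP.<-irrefl (trans (sym (weight-⊕ a b)) w≡) (ℕP.+-mono-<-≤ wa< wb≤)

leading-constₚ : ∀ c → leading 0 (constₚ {n} c) ≡ constₚ c
leading-constₚ {n} c = leading-accept c zeros [] (weight-zeros n)

leading-prodFin : (F : Fin k → Poly n) (N : Fin k → ℕ) → (∀ i → Bounded (N i) (F i)) →
  leading (sum N) (prodFin F) ≡ prodFin (λ i → leading (N i) (F i))
leading-prodFin {k = zero} F N bnd = leading-constₚ (+ 1)
leading-prodFin {k = suc k} F N bnd = trans
  (leading-*ₚ (F Fin.zero) _ (bnd Fin.zero) (bounded-prodFin (F ∘ Fin.suc) (N ∘ Fin.suc) (bnd ∘ Fin.suc)))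
  (cong (leading (N Fin.zero) (F Fin.zero) *ₚ_) (leading-prodFin (F ∘ Fin.suc) (N ∘ Fin.suc) (bnd ∘ Fin.suc)))

leading-powₚ : ∀ {N} (P : Poly n) → Bounded N P → ∀ e → leading (e * N) (powₚ P e) ≡ powₚ (leading N P) e
leading-powₚ P bnd zero = leading-constₚ (+ 1)
leading-powₚ P bnd (suc e) =
  trans (leading-*ₚ P (powₚ P e) bnd (bounded-powₚ bnd e)) (cong (leading _ P *ₚ_) (leading-powₚ P bnd e))

coeff-leading : ∀ N (P : Poly n) {m} → weight m ≡ N → coeff (leading N P) m ≡ coeff P m
coeff-leading N [] wm = refl
coeff-leading N ((c , a) ∷ P) {m} wm with weight a ℕ.≟ N
... | yes wa = begin
  coeff (leading N ((c , a) ∷ P)) m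
    ≡⟨ cong (λ L → coeff L m) (leading-accept c a P wa) ⟩
  coeff ((c , a) ∷ leading N P) m
    ≡⟨ cong (λ z → if does (a ≟ᵉ m) then c ℤ.+ z else z) (coeff-leading N P wm) ⟩
  coeff ((c , a) ∷ P) m ∎
  where open ≡-Reasoning
... | no wa≢ = begin
  coeff (leading N ((c , a) ∷ P)) m  ≡⟨ cong (λ L → coeff L m) (leading-reject c a P wa≢) ⟩
  coeff (leading N P) m              ≡⟨ coeff-leading N P wm ⟩
  coeff P m                          ≡⟨ cong (λ t → if t then c ℤ.+ coeff P m else coeff P m) a≢m ⟨
  coeff ((c , a) ∷ P) m              ∎
  where
  open ≡-Reasoning
  a≢m : does (a ≟ᵉ m) ≡ false
  a≢m = dec-false (a ≟ᵉ m) (λ a≡m → wa≢ (trans (cong weight a≡m) wm))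

leading≡monomial⇒coeff : ∀ N (P : Poly n) {c m} → leading N P ≡ monomial c m → coeff P m ≡ c
leading≡monomial⇒coeff N P {c} {m} L≡ = begin
  coeff P m                  ≡⟨ coeff-leading N P wm ⟨
  coeff (leading N P) m      ≡⟨ cong (λ L → coeff L m) L≡ ⟩
  coeff (monomial c m) m     ≡⟨ cong (λ t → if t then c ℤ.+ + 0 else + 0) (dec-true (m ≟ᵉ m) refl) ⟩
  c ℤ.+ + 0                  ≡⟨ ℤP.+-identityʳ c ⟩
  c                          ∎
  where
  open ≡-Reasoning
  wm : weight m ≡ N
  wm = allTerms-monomial (AllP.all-filter (hasWeight? N) P) L≡

-ₚ-distribˡ-monomial-*ₚ : ∀ c (a : Vec ℕ n) Q → -ₚ (monomial c a *ₚ Q) ≡ monomial (ℤ.- c) a *ₚ Q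
-ₚ-distribˡ-monomial-*ₚ c a [] = refl
-ₚ-distribˡ-monomial-*ₚ c a ((c′ , b) ∷ Q) =
  cong₂ _∷_ (cong (_, a ⊕ b) (ℤP.neg-distribˡ-* c c′)) (-ₚ-distribˡ-monomial-*ₚ c a Q)

-ₚ-distribʳ-monomial-*ₚ : ∀ c (a : Vec ℕ n) Q → -ₚ (monomial c a *ₚ Q) ≡ monomial c a *ₚ (-ₚ Q)
-ₚ-distribʳ-monomial-*ₚ c a [] = refl
-ₚ-distribʳ-monomial-*ₚ c a ((c′ , b) ∷ Q) =
  cong₂ _∷_ (cong (_, a ⊕ b) (ℤP.neg-distribʳ-* c c′)) (-ₚ-distribʳ-monomial-*ₚ c a Q)

-ₚ-++ : (P Q : Poly n) → -ₚ (P ++ Q) ≡ -ₚ P ++ -ₚ Q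
-ₚ-++ = ListP.map-++ _

-ₚ-distribˡ-*ₚ : (P Q : Poly n) → -ₚ (P *ₚ Q) ≡ (-ₚ P) *ₚ Q
-ₚ-distribˡ-*ₚ [] Q = refl
-ₚ-distribˡ-*ₚ ((c , a) ∷ P) Q = begin
  -ₚ (((c , a) ∷ P) *ₚ Q)
    ≡⟨ cong -ₚ_ (*ₚ-∷ˡ c a P Q) ⟩
  -ₚ (monomial c a *ₚ Q ++ P *ₚ Q)
    ≡⟨ -ₚ-++ (monomial c a *ₚ Q) (P *ₚ Q) ⟩
  -ₚ (monomial c a *ₚ Q) ++ -ₚ (P *ₚ Q)
    ≡⟨ cong₂ _++_ (-ₚ-distribˡ-monomial-*ₚ c a Q) (-ₚ-distribˡ-*ₚ P Q) ⟩
  monomial (ℤ.- c) a *ₚ Q ++ (-ₚ P) *ₚ Q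
    ≡⟨ *ₚ-∷ˡ (ℤ.- c) a (-ₚ P) Q ⟨
  (-ₚ ((c , a) ∷ P)) *ₚ Q ∎
  where open ≡-Reasoning

-ₚ-distribʳ-*ₚ : (P Q : Poly n) → -ₚ (P *ₚ Q) ≡ P *ₚ (-ₚ Q)
-ₚ-distribʳ-*ₚ [] Q = refl
-ₚ-distribʳ-*ₚ ((c , a) ∷ P) Q = begin
  -ₚ (((c , a) ∷ P) *ₚ Q)
    ≡⟨ cong -ₚ_ (*ₚ-∷ˡ c a P Q) ⟩
  -ₚ (monomial c a *ₚ Q ++ P *ₚ Q)
    ≡⟨ -ₚ-++ (monomial c a *ₚ Q) (P *ₚ Q) ⟩
  -ₚ (monomial c a *ₚ Q) ++ -ₚ (P *ₚ Q)
    ≡⟨ cong₂ _++_ (-ₚ-distribʳ-monomial-*ₚ c a Q) (-ₚ-distribʳ-*ₚ P Q) ⟩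
  monomial c a *ₚ (-ₚ Q) ++ P *ₚ (-ₚ Q)
    ≡⟨ *ₚ-∷ˡ c a P (-ₚ Q) ⟨
  ((c , a) ∷ P) *ₚ (-ₚ Q) ∎
  where open ≡-Reasoning

infixr 7 _·ᵉ_

_·ᵉ_ : ℕ → Vec ℕ n → Vec ℕ n
zero ·ᵉ a = zeros
suc g ·ᵉ a = a ⊕ g ·ᵉ a

powₚ-monomial : ∀ c (a : Vec ℕ n) g → powₚ (monomial c a) g ≡ monomial (c ℤ.^ g) (g ·ᵉ a)
powₚ-monomial c a zero = refl
powₚ-monomial c a (suc g) = cong (monomial c a *ₚ_) (powₚ-monomial c a g)

record UnitMonomial (Q : Vec ℕ n → Set) (P : Poly n) : Set where
  field
    coefficient : ℤ
    exponent : Vec ℕ n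
    is-monomial : P ≡ monomial coefficient exponent
    coefficient²≡1 : coefficient ℤ.* coefficient ≡ + 1
    satisfies : Q exponent

module _ {Q : Vec ℕ n → Set} (Q-⊕ : ∀ a b → Q a → Q b → Q (a ⊕ b)) (Q-zeros : Q zeros) where

  unitMonomial-*ₚ : {P P′ : Poly n} → UnitMonomial Q P → UnitMonomial Q P′ → UnitMonomial Q (P *ₚ P′)
  unitMonomial-*ₚ u u′ = record
    { coefficient = coefficient u ℤ.* coefficient u′
    ; exponent = exponent u ⊕ exponent u′
    ; is-monomial = cong₂ _*ₚ_ (is-monomial u) (is-monomial u′)
    ; coefficient²≡1 = trans (*-interchange (coefficient u) (coefficient u′) (coefficient u) (coefficient u′))
                             (cong₂ ℤ._*_ (coefficient²≡1 u) (coefficient²≡1 u′))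
    ; satisfies = Q-⊕ (exponent u) (exponent u′) (satisfies u) (satisfies u′)
    }
    where open UnitMonomial

  unitMonomial-1ₚ : UnitMonomial Q 1ₚ
  unitMonomial-1ₚ = record
    { coefficient = + 1 ; exponent = zeros ; is-monomial = refl ; coefficient²≡1 = refl ; satisfies = Q-zeros }

  unitMonomial-prodFin : (F : Fin k → Poly n) → (∀ i → UnitMonomial Q (F i)) → UnitMonomial Q (prodFin F)
  unitMonomial-prodFin {k = zero} F u = unitMonomial-1ₚ
  unitMonomial-prodFin {k = suc k} F u =
    unitMonomial-*ₚ (u Fin.zero) (unitMonomial-prodFin (F ∘ Fin.suc) (u ∘ Fin.suc))

-- The leading monomial of δ

unit : Fin n → Vec ℕ n
unit k = Vec.tabulate λ j → if does (k Fin.≟ j) then 1 else 0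

unit-zero : unit {suc n} Fin.zero ≡ 1 ∷ zeros
unit-zero = cong (1 ∷_) (tabulate-zeros _)
  where
  tabulate-zeros : ∀ n → Vec.tabulate {n = n} (λ _ → 0) ≡ zeros
  tabulate-zeros zero = refl
  tabulate-zeros (suc n) = cong (0 ∷_) (tabulate-zeros n)

degree-unit : (k : Fin n) → degree (unit k) ≡ 1
degree-unit {suc n} Fin.zero = trans (cong degree (unit-zero {n})) (cong suc (degree-zeros n))
degree-unit (Fin.suc k) = degree-unit k

weight-unit : (k : Fin n) → weight (unit k) ≡ toℕ k
weight-unit {suc n} Fin.zero = trans (cong weight (unit-zero {n})) (cong₂ _+_ (weight-zeros n) (degree-zeros n))
weight-unit (Fin.suc k) rewrite weight-unit k | degree-unit k = ℕP.+-comm (toℕ k) 1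

δ-factor : Fin r → Fin r → Poly r
δ-factor i j = if toℕ i ℕ.<ᵇ toℕ j then var i -ₚ var j else 1ₚ

δ-factor-weight : Fin r → Fin r → ℕ
δ-factor-weight i j = if toℕ i ℕ.<ᵇ toℕ j then toℕ j else 0

δ-factor-degree : Fin r → Fin r → ℕ
δ-factor-degree i j = if toℕ i ℕ.<ᵇ toℕ j then 1 else 0

δ-leading-factor : Fin r → Fin r → Poly r
δ-leading-factor i j = if toℕ i ℕ.<ᵇ toℕ j then monomial ℤ.-1ℤ (unit j) else 1ₚ

<ᵇ⇒< : ∀ {x y} → (x ℕ.<ᵇ y) ≡ true → x < y
<ᵇ⇒< {x} {y} x<ᵇy = ℕP.<ᵇ⇒< x y (subst T (sym x<ᵇy) _)

bounded-δ-factor : (i j : Fin r) → Bounded (δ-factor-weight i j) (δ-factor i j)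
bounded-δ-factor i j with toℕ i ℕ.<ᵇ toℕ j in i<j
... | true = ℕP.≤-trans (ℕP.≤-reflexive (weight-unit i)) (ℕP.<⇒≤ (<ᵇ⇒< i<j))
           ∷ ℕP.≤-reflexive (weight-unit j)
           ∷ []
... | false = bounded-constₚ (+ 1)

homogeneous-δ-factor : (i j : Fin r) → Homogeneous (δ-factor-degree i j) (δ-factor i j)
homogeneous-δ-factor i j with toℕ i ℕ.<ᵇ toℕ j
... | true = degree-unit i ∷ degree-unit j ∷ []
... | false = homogeneous-constₚ (+ 1)

leading-δ-factor : (i j : Fin r) → leading (δ-factor-weight i j) (δ-factor i j) ≡ δ-leading-factor i j
leading-δ-factor i j with toℕ i ℕ.<ᵇ toℕ j in i<j
... | true = leading-pair-snd (+ 1) (unit i) ℤ.-1ℤ (unit j)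
               (λ wi≡ → ℕP.<⇒≢ (<ᵇ⇒< i<j) (trans (sym (weight-unit i)) wi≡)) (weight-unit j)
... | false = leading-constₚ (+ 1)

δ-weight : ℕ → ℕ
δ-weight r = sum λ (i : Fin r) → sum (δ-factor-weight i)

δ-degree : ℕ → ℕ
δ-degree r = sum λ (i : Fin r) → sum (δ-factor-degree i)

bounded-δ : ∀ r → Bounded (δ-weight r) (δ r)
bounded-δ r = bounded-prodFin _ _ λ i → bounded-prodFin _ _ (bounded-δ-factor i)

homogeneous-δ : ∀ r → Homogeneous (δ-degree r) (δ r)
homogeneous-δ r = homogeneous-prodFin _ _ λ i → homogeneous-prodFin _ _ (homogeneous-δ-factor i)

leading-δ : ∀ r → leading (δ-weight r) (δ r) ≡ prodFin (λ (i : Fin r) → prodFin (δ-leading-factor i))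
leading-δ r = trans (leading-prodFin _ _ λ i → bounded-prodFin _ _ (bounded-δ-factor i))
  (prodFin-ext λ i → trans (leading-prodFin _ _ (bounded-δ-factor i)) (prodFin-ext (leading-δ-factor i)))

x₁-free : Vec ℕ (suc n) → Set
x₁-free a = Vec.head a ≡ 0

x₁-free-⊕ : (a b : Vec ℕ (suc n)) → x₁-free a → x₁-free b → x₁-free (a ⊕ b)
x₁-free-⊕ (_ ∷ _) (_ ∷ _) refl refl = refl

unitMonomial-δ-leading-factor : (i j : Fin (suc r)) → UnitMonomial x₁-free (δ-leading-factor i j)
unitMonomial-δ-leading-factor i j with toℕ i ℕ.<ᵇ toℕ j in i<j
unitMonomial-δ-leading-factor i Fin.zero | true = ⊥-elim (ℕP.n≮0 {toℕ i} (<ᵇ⇒< i<j))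
unitMonomial-δ-leading-factor i (Fin.suc j) | true = record
  { coefficient = ℤ.-1ℤ
  ; exponent = unit (Fin.suc j)
  ; is-monomial = refl
  ; coefficient²≡1 = refl
  ; satisfies = refl
  }
... | false = unitMonomial-1ₚ x₁-free-⊕ refl

unitMonomial-δ-leading : ∀ r → UnitMonomial x₁-free (prodFin (λ (i : Fin (suc r)) → prodFin (δ-leading-factor i)))
unitMonomial-δ-leading r = unitMonomial-prodFin x₁-free-⊕ refl _ λ i →
  unitMonomial-prodFin x₁-free-⊕ refl _ (unitMonomial-δ-leading-factor i)

swap₁₂ : Vec ℕ (suc (suc n)) → Vec ℕ (suc (suc n))
swap₁₂ (x ∷ y ∷ v) = y ∷ x ∷ v

swap₁₂-⊕ : (a b : Vec ℕ (suc (suc n))) → swap₁₂ (a ⊕ b) ≡ swap₁₂ a ⊕ swap₁₂ b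
swap₁₂-⊕ (_ ∷ _ ∷ _) (_ ∷ _ ∷ _) = refl

swap₁₂-involutive : (a : Vec ℕ (suc (suc n))) → swap₁₂ (swap₁₂ a) ≡ a
swap₁₂-involutive (_ ∷ _ ∷ _) = refl

weight-swap₁₂-unit-≤ : ∀ {t} (k : Fin (suc (suc n))) →
  toℕ k ≤ t → 1 ≤ t → weight (swap₁₂ (unit k)) ≤ t
weight-swap₁₂-unit-≤ {n} Fin.zero _ 1≤t =
  ℕP.≤-trans (ℕP.≤-reflexive (weight-unit {suc (suc n)} (Fin.suc Fin.zero))) 1≤t
weight-swap₁₂-unit-≤ {n} (Fin.suc Fin.zero) _ _ =
  ℕP.≤-trans (ℕP.≤-reflexive (weight-unit {suc (suc n)} Fin.zero)) z≤n
weight-swap₁₂-unit-≤ (Fin.suc (Fin.suc k)) k≤t _ =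
  ℕP.≤-trans (ℕP.≤-reflexive (weight-unit (Fin.suc (Fin.suc k)))) k≤t

bounded-swap₁₂-δ-factor : (i j : Fin (suc (suc r))) →
  Bounded (δ-factor-weight i j) (mapExp swap₁₂ (δ-factor i j))
bounded-swap₁₂-δ-factor i j with toℕ i ℕ.<ᵇ toℕ j in i<j
... | true = weight-swap₁₂-unit-≤ i (ℕP.<⇒≤ (<ᵇ⇒< i<j)) 1≤j
           ∷ weight-swap₁₂-unit-≤ j ℕP.≤-refl 1≤j
           ∷ []
  where
  1≤j : 1 ≤ toℕ j
  1≤j = ℕP.≤-trans (s≤s z≤n) (<ᵇ⇒< i<j)
... | false = bounded-constₚ (+ 1)

module _ {r : ℕ} where

  private
    R : ℕ
    R = suc (suc r)

    0≢2+ : ∀ {t} → 0 ≢ suc (suc t)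
    0≢2+ ()

    1≢2+ : ∀ {t} → 1 ≢ suc (suc t)
    1≢2+ ()

  leading-swapped : Fin R → Fin R → Poly R
  leading-swapped i j = leading (δ-factor-weight i j) (mapExp swap₁₂ (δ-factor i j))

  leading-swapped-01 : leading-swapped Fin.zero (Fin.suc Fin.zero) ≡ -ₚ δ-leading-factor Fin.zero (Fin.suc Fin.zero)
  leading-swapped-01 = leading-pair-fst (+ 1) (unit (Fin.suc Fin.zero)) ℤ.-1ℤ (unit Fin.zero)
    (weight-unit {R} (Fin.suc Fin.zero)) (λ w≡1 → ℕP.0≢1+n (trans (sym (weight-unit {R} Fin.zero)) w≡1))

  leading-swapped-0 : (j : Fin r) →
    leading-swapped Fin.zero (Fin.suc (Fin.suc j)) ≡ δ-leading-factor Fin.zero (Fin.suc (Fin.suc j))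
  leading-swapped-0 j = leading-pair-snd (+ 1) (unit (Fin.suc Fin.zero)) ℤ.-1ℤ (unit (Fin.suc (Fin.suc j)))
    (λ w≡ → 1≢2+ (trans (sym (weight-unit {R} (Fin.suc Fin.zero))) w≡)) (weight-unit (Fin.suc (Fin.suc j)))

  leading-swapped-suc : (i : Fin (suc r)) (j : Fin R) → leading-swapped (Fin.suc i) j ≡ δ-leading-factor (Fin.suc i) j
  leading-swapped-suc i Fin.zero = leading-constₚ (+ 1)
  leading-swapped-suc i (Fin.suc j) with toℕ i ℕ.<ᵇ toℕ j in i<j
  ... | false = leading-constₚ (+ 1)
  leading-swapped-suc i (Fin.suc Fin.zero) | true = ⊥-elim (ℕP.n≮0 {toℕ i} (<ᵇ⇒< i<j))
  leading-swapped-suc Fin.zero (Fin.suc (Fin.suc j)) | true =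
    leading-pair-snd (+ 1) (unit Fin.zero) ℤ.-1ℤ (unit (Fin.suc (Fin.suc j)))
      (λ w≡ → 0≢2+ (trans (sym (weight-unit {R} Fin.zero)) w≡)) (weight-unit (Fin.suc (Fin.suc j)))
  leading-swapped-suc (Fin.suc i) (Fin.suc (Fin.suc j)) | true =
    leading-pair-snd (+ 1) (unit (Fin.suc (Fin.suc i))) ℤ.-1ℤ (unit (Fin.suc (Fin.suc j)))
      (λ w≡ → ℕP.<⇒≢ (s≤s (<ᵇ⇒< i<j)) (trans (sym (weight-unit (Fin.suc (Fin.suc i)))) w≡))
      (weight-unit (Fin.suc (Fin.suc j)))

  mapExp-swap₁₂-δ : mapExp swap₁₂ (δ R) ≡ prodFin λ i → prodFin λ j → mapExp swap₁₂ (δ-factor i j)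
  mapExp-swap₁₂-δ = trans (mapExp-prodFin swap₁₂ swap₁₂-⊕ refl (λ i → prodFin (δ-factor i)))
    (prodFin-ext λ i → mapExp-prodFin swap₁₂ swap₁₂-⊕ refl (δ-factor i))

  bounded-swap₁₂-δ : Bounded (δ-weight R) (mapExp swap₁₂ (δ R))
  bounded-swap₁₂-δ = subst (Bounded _) (sym mapExp-swap₁₂-δ)
    (bounded-prodFin _ _ λ i → bounded-prodFin _ _ (bounded-swap₁₂-δ-factor i))

  -- Exchanging x₁ and x₂ changes the leading term only of the factor x₁ − x₂, and only by a sign.
  leading-swap₁₂-δ : leading (δ-weight R) (mapExp swap₁₂ (δ R)) ≡
                     -ₚ prodFin (λ i → prodFin (δ-leading-factor i))
  leading-swap₁₂-δ = begin
    leading (δ-weight R) (mapExp swap₁₂ (δ R))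
      ≡⟨ cong (leading (δ-weight R)) mapExp-swap₁₂-δ ⟩
    leading (δ-weight R) (prodFin λ i → prodFin λ j → mapExp swap₁₂ (δ-factor i j))
      ≡⟨ leading-prodFin (λ i → prodFin λ j → mapExp swap₁₂ (δ-factor i j))
                         (λ i → sum (δ-factor-weight i))
           (λ i → bounded-prodFin _ _ (bounded-swap₁₂-δ-factor i)) ⟩
    prodFin (λ i → leading (sum (δ-factor-weight i)) (prodFin λ j → mapExp swap₁₂ (δ-factor i j)))
      ≡⟨ prodFin-ext (λ i → leading-prodFin (λ j → mapExp swap₁₂ (δ-factor i j)) (δ-factor-weight i)
                                             (bounded-swap₁₂-δ-factor i)) ⟩
    (leading-swapped 0F 0F *ₚ (leading-swapped 0F 1F *ₚ prodFin (leading-swapped 0F ∘ Fin.suc ∘ Fin.suc))) *ₚ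
      prodFin (λ i → prodFin (leading-swapped (Fin.suc i)))
      ≡⟨ cong₂ _*ₚ_ (cong₂ _*ₚ_ (leading-constₚ {R} (+ 1))
                       (cong₂ _*ₚ_ leading-swapped-01 (prodFin-ext leading-swapped-0)))
                    (prodFin-ext λ i → prodFin-ext (leading-swapped-suc i)) ⟩
    (L 0F 0F *ₚ ((-ₚ L 0F 1F) *ₚ prodFin (L 0F ∘ Fin.suc ∘ Fin.suc))) *ₚ
      prodFin (λ i → prodFin (L (Fin.suc i)))
      ≡⟨ negate-middle (L 0F 0F) (L 0F 1F) (prodFin (L 0F ∘ Fin.suc ∘ Fin.suc))
                       (prodFin (λ i → prodFin (L (Fin.suc i)))) ⟩
    -ₚ prodFin (λ i → prodFin (L i)) ∎
    where
    open ≡-Reasoning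
    0F 1F : Fin R
    0F = Fin.zero
    1F = Fin.suc Fin.zero
    L : Fin R → Fin R → Poly R
    L = δ-leading-factor
    negate-middle : (A B C D : Poly R) → (A *ₚ ((-ₚ B) *ₚ C)) *ₚ D ≡ -ₚ ((A *ₚ (B *ₚ C)) *ₚ D)
    negate-middle A B C D = begin
      (A *ₚ ((-ₚ B) *ₚ C)) *ₚ D     ≡⟨ cong (λ X → (A *ₚ X) *ₚ D) (-ₚ-distribˡ-*ₚ B C) ⟨
      (A *ₚ (-ₚ (B *ₚ C))) *ₚ D     ≡⟨ cong (_*ₚ D) (-ₚ-distribʳ-*ₚ A (B *ₚ C)) ⟨
      (-ₚ (A *ₚ (B *ₚ C))) *ₚ D     ≡⟨ -ₚ-distribˡ-*ₚ (A *ₚ (B *ₚ C)) D ⟨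
      -ₚ ((A *ₚ (B *ₚ C)) *ₚ D)     ∎

sum-ones : ∀ n → sum (λ (_ : Fin n) → 1) ≡ n
sum-ones zero = refl
sum-ones (suc n) = cong suc (sum-ones n)

triangular-step : ∀ n → 2 * n + n * (n ∸ 1) ≡ suc n * n
triangular-step zero = refl
triangular-step (suc n) = solve n
  where
  solve : ∀ n → 2 * suc n + suc n * n ≡ suc (suc n) * suc n
  solve = ℕ-Solver.solve-∀

twice-sum-toℕ : ∀ n → 2 * sum (toℕ {n}) ≡ n * (n ∸ 1)
twice-sum-toℕ zero = refl
twice-sum-toℕ (suc n) = begin
  2 * sum (λ i → suc (toℕ {n} i))          ≡⟨ cong (2 *_) (∑-distrib-+ {n} (λ _ → 1) toℕ) ⟩
  2 * (sum (λ (_ : Fin n) → 1) + sum (toℕ {n}))    ≡⟨ cong (λ x → 2 * (x + sum (toℕ {n}))) (sum-ones n) ⟩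
  2 * (n + sum (toℕ {n}))                  ≡⟨ ℕP.*-distribˡ-+ 2 n _ ⟩
  2 * n + 2 * sum (toℕ {n})                ≡⟨ cong (_+_ (2 * n)) (twice-sum-toℕ n) ⟩
  2 * n + n * (n ∸ 1)                      ≡⟨ triangular-step n ⟩
  suc n * n                                ∎
  where open ≡-Reasoning

count-above : ∀ n k → sum (λ (j : Fin n) → if k ℕ.<ᵇ toℕ j then 1 else 0) ≡ n ∸ suc k
count-above zero k = refl
count-above (suc n) zero = sum-ones n
count-above (suc n) (suc k) = count-above n k

twice-δ-degree : ∀ r → 2 * δ-degree r ≡ r * (r ∸ 1)
twice-δ-degree r = trans (cong (2 *_) counted) (twice-sum r)
  where
  counted : δ-degree r ≡ sum (λ (i : Fin r) → r ∸ suc (toℕ i))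
  counted = sum-cong-≗ {r} (λ i → count-above r (toℕ i))
  twice-sum : ∀ r → 2 * sum (λ (i : Fin r) → r ∸ suc (toℕ i)) ≡ r * (r ∸ 1)
  twice-sum zero = refl
  twice-sum (suc r) = begin
    2 * (r + sum (λ (i : Fin r) → r ∸ suc (toℕ i)))          ≡⟨ ℕP.*-distribˡ-+ 2 r _ ⟩
    2 * r + 2 * sum (λ (i : Fin r) → r ∸ suc (toℕ i))        ≡⟨ cong (_+_ (2 * r)) (twice-sum r) ⟩
    2 * r + r * (r ∸ 1)                                      ≡⟨ triangular-step r ⟩
    suc r * r                                                ∎
    where open ≡-Reasoning

-- A monomial of δ^g with unit coefficient

x₁-free-·ᵉ : ∀ g (a : Vec ℕ (suc n)) → x₁-free a → x₁-free (g ·ᵉ a)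
x₁-free-·ᵉ zero a _ = refl
x₁-free-·ᵉ (suc g) a a-free = x₁-free-⊕ a (g ·ᵉ a) a-free (x₁-free-·ᵉ g a a-free)

module PowerOfδ (r g : ℕ) where

  private
    R : ℕ
    R = suc (suc r)

  open UnitMonomial (unitMonomial-δ-leading (suc r)) public
    renaming (coefficient to sign; coefficient²≡1 to sign²≡1; exponent to m)

  μ : Vec ℕ R
  μ = g ·ᵉ m

  x₁-free-μ : x₁-free μ
  x₁-free-μ = x₁-free-·ᵉ g m satisfies

  leading-δ^g : leading (g * δ-weight R) (powₚ (δ R) g) ≡ monomial (sign ℤ.^ g) μ
  leading-δ^g = begin
    leading (g * δ-weight R) (powₚ (δ R) g)  ≡⟨ leading-powₚ (δ R) (bounded-δ R) g ⟩
    powₚ (leading (δ-weight R) (δ R)) g      ≡⟨ cong (λ L → powₚ L g) (trans (leading-δ R) is-monomial) ⟩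
    powₚ (monomial sign m) g                 ≡⟨ powₚ-monomial sign m g ⟩
    monomial (sign ℤ.^ g) μ                  ∎
    where open ≡-Reasoning

  leading-swap₁₂-δ^g : leading (g * δ-weight R) (mapExp swap₁₂ (powₚ (δ R) g)) ≡ monomial ((ℤ.- sign) ℤ.^ g) μ
  leading-swap₁₂-δ^g = begin
    leading (g * δ-weight R) (mapExp swap₁₂ (powₚ (δ R) g))
      ≡⟨ cong (leading _) (mapExp-powₚ swap₁₂ swap₁₂-⊕ refl (δ R) g) ⟩
    leading (g * δ-weight R) (powₚ (mapExp swap₁₂ (δ R)) g)
      ≡⟨ leading-powₚ (mapExp swap₁₂ (δ R)) (bounded-swap₁₂-δ {r}) g ⟩
    powₚ (leading (δ-weight R) (mapExp swap₁₂ (δ R))) g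
      ≡⟨ cong (λ L → powₚ L g) (trans leading-swap₁₂-δ (cong -ₚ_ is-monomial)) ⟩
    powₚ (monomial (ℤ.- sign) m) g
      ≡⟨ powₚ-monomial (ℤ.- sign) m g ⟩
    monomial ((ℤ.- sign) ℤ.^ g) μ ∎
    where open ≡-Reasoning

  coeff-δ^g-μ : coeff (powₚ (δ R) g) μ ≡ sign ℤ.^ g
  coeff-δ^g-μ = leading≡monomial⇒coeff _ (powₚ (δ R) g) leading-δ^g

  coeff-δ^g-swap₁₂-μ : coeff (powₚ (δ R) g) (swap₁₂ μ) ≡ (ℤ.- sign) ℤ.^ g
  coeff-δ^g-swap₁₂-μ = trans (sym (coeff-mapExp-involution swap₁₂ swap₁₂-involutive (powₚ (δ R) g) μ))
    (leading≡monomial⇒coeff _ (mapExp swap₁₂ (powₚ (δ R) g)) leading-swap₁₂-δ^g)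

  twice-degree-μ : 2 * degree μ ≡ g * (R * (R ∸ 1))
  twice-degree-μ = begin
    2 * degree μ           ≡⟨ cong (2 *_) (allTerms-monomial (AllP.filter⁺ (hasWeight? _) homogeneous-δ^g) leading-δ^g) ⟩
    2 * (g * δ-degree R)   ≡⟨ ℕP.*-comm 2 (g * δ-degree R) ⟩
    g * δ-degree R * 2     ≡⟨ ℕP.*-assoc g (δ-degree R) 2 ⟩
    g * (δ-degree R * 2)   ≡⟨ cong (g *_) (trans (ℕP.*-comm (δ-degree R) 2) (twice-δ-degree R)) ⟩
    g * (R * (R ∸ 1))      ∎
    where
    open ≡-Reasoning
    homogeneous-δ^g : Homogeneous (g * δ-degree R) (powₚ (δ R) g)
    homogeneous-δ^g = homogeneous-powₚ (homogeneous-δ R) g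

homogeneous-fpoly : ∀ r → Homogeneous r (fpoly r)
homogeneous-fpoly r = subst (λ N → Homogeneous N (fpoly r)) (sum-ones r)
  (homogeneous-prodFin (λ i → var Fin.zero -ₚ var (Fin.suc i)) (λ _ → 1)
     λ i → degree-unit {suc r} Fin.zero ∷ degree-unit (Fin.suc i) ∷ [])

allTerms-coeffX : {Q : Vec ℕ r → Set} (k : ℕ) (P : Poly (suc r)) →
  AllTerms (λ v → Vec.head v ≡ k → Q (Vec.tail v)) P → AllTerms Q (coeffX k P)
allTerms-coeffX k [] [] = []
allTerms-coeffX k ((c , (a ∷ as)) ∷ P) (q ∷ qs) with a ℕ.≡ᵇ k in a≡ᵇk
... | true = q (ℕP.≡ᵇ⇒≡ a k (subst T (sym a≡ᵇk) _)) ∷ allTerms-coeffX k P qs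
... | false = allTerms-coeffX k P qs

entry-homogeneous : ∀ {p r e d} → d ≤ p → (i j : Fin d) →
  AllTerms (λ a → degree a + (suc (toℕ i) * p + toℕ j) ≡ e * r + d) (Mmat p r e d i j)
entry-homogeneous {p} {r} {e} {d} d≤p i j =
  allTerms-coeffX _ _ (All.map (λ {t} → shift (proj₂ t)) (homogeneous-powₚ (homogeneous-fpoly r) e))
  where
  X : ℕ
  X = suc (toℕ i) * p + toℕ j
  d≤X : d ≤ X
  d≤X = ℕP.≤-trans d≤p (ℕP.≤-trans (ℕP.m≤m+n p (toℕ i * p)) (ℕP.m≤m+n _ (toℕ j)))
  shift : (v : Vec ℕ (suc r)) → degree v ≡ e * r → Vec.head v ≡ X ∸ d → degree (Vec.tail v) + X ≡ e * r + d
  shift (a ∷ as) deg-v a≡X∸d = begin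
    degree as + X               ≡⟨ cong (_+_ (degree as)) (ℕP.m∸n+n≡m d≤X) ⟨
    degree as + (X ∸ d + d)     ≡⟨ ℕP.+-assoc (degree as) (X ∸ d) d ⟨
    degree as + (X ∸ d) + d     ≡⟨ cong (λ z → degree as + z + d) a≡X∸d ⟨
    degree as + a + d           ≡⟨ cong (_+ d) (trans (ℕP.+-comm (degree as) a) deg-v) ⟩
    e * r + d                   ∎
    where open ≡-Reasoning

degree-x-x₁ : Vec ℕ (suc (suc n)) → ℕ
degree-x-x₁ (x ∷ y ∷ _) = x + y

degree-x-x₁-⊕ : (a b : Vec ℕ (suc (suc n))) → degree-x-x₁ (a ⊕ b) ≡ degree-x-x₁ a + degree-x-x₁ b
degree-x-x₁-⊕ (x ∷ y ∷ _) (x′ ∷ y′ ∷ _) = +-interchange x x′ y y′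

degree-x-x₁-powₚ-fpoly : ∀ r e → AllTerms (λ a → e ≤ degree-x-x₁ a) (powₚ (fpoly (suc r)) e)
degree-x-x₁-powₚ-fpoly r zero = All.universal (λ _ → z≤n) _
degree-x-x₁-powₚ-fpoly r (suc e) =
  allTerms-*ₚ (λ {a} {b} → add {a} {b}) first-factor (degree-x-x₁-powₚ-fpoly r e)
  where
  add : ∀ {a b : Vec ℕ (suc (suc r))} →
    1 ≤ degree-x-x₁ a → e ≤ degree-x-x₁ b → suc e ≤ degree-x-x₁ (a ⊕ b)
  add {a} {b} 1≤a e≤b = subst (suc e ≤_) (sym (degree-x-x₁-⊕ a b)) (ℕP.+-mono-≤ 1≤a e≤b)
  first-factor : AllTerms (λ a → 1 ≤ degree-x-x₁ a) (fpoly (suc r))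
  first-factor = allTerms-*ₚ (λ {a} {b} → keep {a} {b}) {P = var Fin.zero -ₚ var (Fin.suc Fin.zero)}
    (s≤s z≤n ∷ s≤s z≤n ∷ [])
    (All.universal (λ _ → z≤n) (prodFin λ (i : Fin r) → var Fin.zero -ₚ var (Fin.suc (Fin.suc i))))
    where
    keep : ∀ {a b : Vec ℕ (suc (suc r))} →
      1 ≤ degree-x-x₁ a → 0 ≤ degree-x-x₁ b → 1 ≤ degree-x-x₁ (a ⊕ b)
    keep {a} {b} 1≤a _ = subst (1 ≤_) (sym (degree-x-x₁-⊕ a b)) (ℕP.≤-trans 1≤a (ℕP.m≤m+n _ _))

x₁-divides-⊕ˡ : (a b : Vec ℕ (suc n)) → 1 ≤ Vec.head a → 1 ≤ Vec.head (a ⊕ b)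
x₁-divides-⊕ˡ (x ∷ _) (y ∷ _) 1≤x = ℕP.≤-trans 1≤x (ℕP.m≤m+n x y)

x₁-divides-⊕ʳ : (a b : Vec ℕ (suc n)) → 1 ≤ Vec.head b → 1 ≤ Vec.head (a ⊕ b)
x₁-divides-⊕ʳ (x ∷ _) (y ∷ _) 1≤y = ℕP.≤-trans 1≤y (ℕP.m≤n+m y x)

first-row-index< : ∀ p t D → t < D → suc p + t ∸ D < suc p
first-row-index< p t D t<D =
  s≤s (ℕP.≤-trans (ℕP.∸-monoʳ-≤ (suc p + t) t<D) (ℕP.≤-reflexive (ℕP.m+n∸n≡m p t)))

first-row-in-x₁ : ∀ {p r e d} → suc d ≤ p → p ≤ e → (j : Fin (suc d)) →
  AllTerms (λ a → 1 ≤ Vec.head a) (Mmat p (suc r) e (suc d) Fin.zero j)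
first-row-in-x₁ {suc p} {r} {e} {d} D≤p p≤e j =
  allTerms-coeffX _ _ (All.map (λ {t} → x₁-divides (proj₂ t)) (degree-x-x₁-powₚ-fpoly r e))
  where
  index : ℕ
  index = 1 * suc p + toℕ j ∸ suc d
  index<e : index < e
  index<e = ℕP.<-≤-trans (subst (λ x → x + toℕ j ∸ suc d < suc p) (sym (ℕP.*-identityˡ (suc p)))
          (first-row-index< p (toℕ j) (suc d) (FinP.toℕ<n j))) p≤e
  x₁-divides : (v : Vec ℕ (suc (suc r))) → e ≤ degree-x-x₁ v → Vec.head v ≡ index → 1 ≤ Vec.head (Vec.tail v)
  x₁-divides (.index ∷ zero ∷ _) e≤index+0 refl =
    ⊥-elim (ℕP.<⇒≱ index<e (ℕP.≤-trans e≤index+0 (ℕP.≤-reflexive (ℕP.+-identityʳ index))))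
  x₁-divides (.index ∷ suc b ∷ _) _ refl = s≤s z≤n

-- Symmetry of det M_d(f^e) in x₁ and x₂

onTail-swap₁₂-⊕ : (a b : Vec ℕ (suc (suc (suc n)))) →
  onTail swap₁₂ (a ⊕ b) ≡ onTail swap₁₂ a ⊕ onTail swap₁₂ b
onTail-swap₁₂-⊕ (_ ∷ _ ∷ _ ∷ _) (_ ∷ _ ∷ _ ∷ _) = refl

fpoly-symmetric₁₂ : ∀ {p} r → mapExp (onTail swap₁₂) (fpoly (suc (suc r))) ≃ fpoly (suc (suc r)) [mod p ]
fpoly-symmetric₁₂ r = ≃-trans (≃-reflexive swapped) (*ₚ-left-comm X₂ X₁ Rest)
  where
  σ : Vec ℕ (suc (suc (suc r))) → Vec ℕ (suc (suc (suc r)))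
  σ = onTail swap₁₂
  X₁ X₂ Rest : Poly (suc (suc (suc r)))
  X₁ = var Fin.zero -ₚ var (Fin.suc Fin.zero)
  X₂ = var Fin.zero -ₚ var (Fin.suc (Fin.suc Fin.zero))
  X₃₊ : Fin r → Poly (suc (suc (suc r)))
  X₃₊ i = var Fin.zero -ₚ var (Fin.suc (Fin.suc (Fin.suc i)))
  Rest = prodFin X₃₊
  swapped : mapExp σ (X₁ *ₚ (X₂ *ₚ Rest)) ≡ X₂ *ₚ (X₁ *ₚ Rest)
  swapped = begin
    mapExp σ (X₁ *ₚ (X₂ *ₚ Rest))         ≡⟨ mapExp-*ₚ σ onTail-swap₁₂-⊕ refl X₁ (X₂ *ₚ Rest) ⟩
    mapExp σ X₁ *ₚ mapExp σ (X₂ *ₚ Rest)  ≡⟨ cong (mapExp σ X₁ *ₚ_) (mapExp-*ₚ σ onTail-swap₁₂-⊕ refl X₂ Rest) ⟩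
    X₂ *ₚ (X₁ *ₚ mapExp σ Rest)           ≡⟨ cong (λ Y → X₂ *ₚ (X₁ *ₚ Y)) (mapExp-prodFin σ onTail-swap₁₂-⊕ refl X₃₊) ⟩
    X₂ *ₚ (X₁ *ₚ Rest)                    ∎
    where open ≡-Reasoning

det-symmetric₁₂ : ∀ p r e d → mapExp swap₁₂ (det (Mmat p (suc (suc r)) e d)) ≃ det (Mmat p (suc (suc r)) e d) [mod p ]
det-symmetric₁₂ p r e d = ≃-trans (≃-reflexive (mapExp-det swap₁₂ swap₁₂-⊕ refl (Mmat p (suc (suc r)) e d)))
                                  (det-cong {k = d} λ i j → entry (suc (toℕ i) * p + toℕ j ∸ d))
  where
  f : Poly (suc (suc (suc r)))
  f = fpoly (suc (suc r))
  entry : ∀ k → mapExp swap₁₂ (coeffX k (powₚ f e)) ≃ coeffX k (powₚ f e) [mod p ]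
  entry k = ≃-trans
    (≃-reflexive (trans (sym (coeffX-mapExp swap₁₂ k (powₚ f e)))
                        (cong (coeffX k) (mapExp-powₚ (onTail swap₁₂) onTail-swap₁₂-⊕ refl f e))))
    (coeffX-cong k (powₚ-cong (fpoly-symmetric₁₂ r) e))

coeff-det-swap₁₂ : ∀ p r e d m →
  coeff (det (Mmat p (suc (suc r)) e d)) (swap₁₂ m) ≡ coeff (det (Mmat p (suc (suc r)) e d)) m [mod p ]
coeff-det-swap₁₂ p r e d m = mod-trans
  (mod-reflexive (sym (coeff-mapExp-involution swap₁₂ swap₁₂-involutive (det (Mmat p (suc (suc r)) e d)) m)))
  (coeff-mod (det-symmetric₁₂ p r e d) m)

module _ {p : ℕ} (u : ℤ) (u²≡1 : u ℤ.* u ≡ + 1) where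

  ∣unit-multiple⇒∣ : ∀ k → + p ∣ + k ℤ.* u → p ℕD.∣ k
  ∣unit-multiple⇒∣ k p∣ku = ∣⇒∣ᵤ (subst (+ p ∣_) cancel (∣m⇒∣m*n u p∣ku))
    where
    cancel : + k ℤ.* u ℤ.* u ≡ + k
    cancel = trans (ℤP.*-assoc (+ k) u u) (trans (cong (+ k ℤ.*_) u²≡1) (ℤP.*-identityʳ (+ k)))

  ∤-unit-multiple : ∀ {ε} → 1 ≤ ε → ε < p → ¬ (+ p ∣ + ε ℤ.* u)
  ∤-unit-multiple {suc ε} _ ε<p p∣εu = ℕP.<⇒≱ ε<p (ℕD.∣⇒≤ (∣unit-multiple⇒∣ (suc ε) p∣εu))

  ∣-twice-unit-multiple⇒≡2 : ∀ {ε} → Prime p → 1 ≤ ε → ε < p → + p ∣ + 2 ℤ.* (+ ε ℤ.* u) → p ≡ 2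
  ∣-twice-unit-multiple⇒≡2 {ε} p-prime 1≤ε ε<p p∣2εu =
    [ p∣2⇒p≡2 , absurd-p∣ε ]′ (euclidsLemma 2 ε p-prime p∣2ε)
    where
    p∣2ε : p ℕD.∣ 2 * ε
    p∣2ε = ∣unit-multiple⇒∣ (2 * ε)
      (subst (+ p ∣_) (trans (sym (ℤP.*-assoc (+ 2) (+ ε) u)) (cong (ℤ._* u) (sym (ℤP.pos-* 2 ε)))) p∣2εu)
    p∣2⇒p≡2 : p ℕD.∣ 2 → p ≡ 2
    p∣2⇒p≡2 p∣2 = ℕP.≤-antisym (ℕD.∣⇒≤ p∣2) (ℕ.nonTrivial⇒n>1 p {{prime⇒nonTrivial p-prime}})
    absurd-p∣ε : p ℕD.∣ ε → p ≡ 2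
    absurd-p∣ε p∣ε = ⊥-elim (ℕP.<⇒≱ ε<p (ℕD.∣⇒≤ {{ℕ.>-nonZero 1≤ε}} p∣ε))

^-unit : ∀ u → u ℤ.* u ≡ + 1 → ∀ g → u ℤ.^ g ℤ.* u ℤ.^ g ≡ + 1
^-unit u u²≡1 zero = refl
^-unit u u²≡1 (suc g) = trans (*-interchange u (u ℤ.^ g) u (u ℤ.^ g)) (cong₂ ℤ._*_ u²≡1 (^-unit u u²≡1 g))

even-or-odd : ∀ g → ∃ λ q → g ≡ q + q ⊎ g ≡ suc (q + q)
even-or-odd zero = 0 , inj₁ refl
even-or-odd (suc g) with even-or-odd g
... | q , inj₁ g≡q+q = q , inj₂ (cong suc g≡q+q)
... | q , inj₂ g≡1+q+q = suc q , inj₁ (trans (cong suc g≡1+q+q) (sym (ℕP.+-suc (suc q) q)))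

neg-^-even : ∀ x q → (ℤ.- x) ℤ.^ (q + q) ≡ x ℤ.^ (q + q)
neg-^-even x zero = refl
neg-^-even x (suc q) rewrite ℕP.+-suc q q =
  trans (cong (λ y → ℤ.- x ℤ.* (ℤ.- x ℤ.* y)) (neg-^-even x q)) (square x (x ℤ.^ (q + q)))
  where
  square : ∀ x y → ℤ.- x ℤ.* (ℤ.- x ℤ.* y) ≡ x ℤ.* (x ℤ.* y)
  square = ℤ-Solver.solve-∀

neg-^-odd : ∀ x {g} q → g ≡ suc (q + q) → (ℤ.- x) ℤ.^ g ≡ ℤ.- (x ℤ.^ g)
neg-^-odd x q refl = trans (cong (ℤ.- x ℤ.*_) (neg-^-even x q)) (sym (ℤP.neg-distribˡ-* x (x ℤ.^ (q + q))))

m+n≡o⇒+m≡+o-+n : ∀ {m n o} → m + n ≡ o → + m ≡ + o ℤ.- + n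
m+n≡o⇒+m≡+o-+n {m} {n} refl = sym (trans (cong (ℤ._- + n) (ℤP.pos-+ m n)) (cancel (+ m) (+ n)))
  where
  cancel : ∀ x y → x ℤ.+ y ℤ.- y ≡ x
  cancel = ℤ-Solver.solve-∀

degree-equation⇒g-formula : ∀ {x deg S d P e R} → 2 * deg ≡ x → 2 * S ≡ suc d * d →
  deg + ((suc d + S) * suc P + S) ≡ suc d * (e * R + suc d) →
  x + suc d * (suc d + 1) * P ≡ 2 * R * e * suc d
degree-equation⇒g-formula {x} {deg} {S} {d} {P} {e} {R} 2deg≡x 2S≡Dd deg-eq =
  ℕP.+-cancelʳ-≡ (2 * D * D) _ _ (begin
    x + D * (D + 1) * P + 2 * D * D
      ≡⟨ expand x d P ⟩
    x + (D * d) * suc P + 2 * D * suc P + D * d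
      ≡⟨ cong₂ (λ y z → y + z * suc P + 2 * D * suc P + z) (sym 2deg≡x) (sym 2S≡Dd) ⟩
    2 * deg + (2 * S) * suc P + 2 * D * suc P + 2 * S
      ≡⟨ collect deg S d P ⟩
    2 * (deg + ((D + S) * suc P + S))
      ≡⟨ cong (2 *_) deg-eq ⟩
    2 * (D * (e * R + D))
      ≡⟨ distribute d e R ⟩
    2 * R * e * D + 2 * D * D ∎)
  where
  open ≡-Reasoning
  D : ℕ
  D = suc d
  expand : ∀ x d P →
    x + suc d * (suc d + 1) * P + 2 * suc d * suc d ≡ x + (suc d * d) * suc P + 2 * suc d * suc P + suc d * d
  expand = ℕ-Solver.solve-∀
  collect : ∀ deg S d P → 2 * deg + (2 * S) * suc P + 2 * suc d * suc P + 2 * S ≡ 2 * (deg + ((suc d + S) * suc P + S))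
  collect = ℕ-Solver.solve-∀
  distribute : ∀ d e R → 2 * (suc d * (e * R + suc d)) ≡ 2 * R * e * suc d + 2 * suc d * suc d
  distribute = ℕ-Solver.solve-∀

-- Consequences of det M ≡ ε·δ^g

module DeterminantFormula
  (P r e d : ℕ) {ε g : ℕ} (1≤ε : 1 ≤ ε) (ε<p : ε < suc (suc P)) (D≤p : suc d ≤ suc (suc P))
  (det≃εδ^g : det (Mmat (suc (suc P)) (suc (suc r)) e (suc d))
                ≃ constₚ (+ ε) *ₚ powₚ (δ (suc (suc r))) g [mod suc (suc P) ])
  where

  private
    p R D : ℕ
    p = suc (suc P)
    R = suc (suc r)
    D = suc d
    M : Fin D → Fin D → Poly R
    M = Mmat p R e D
    open PowerOfδ r g

    coeff-det-εδ^g : ∀ m → coeff (det M) m ≡ + ε ℤ.* coeff (powₚ (δ R) g) m [mod p ]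
    coeff-det-εδ^g m =
      mod-trans (coeff-mod det≃εδ^g m) (mod-reflexive (coeff-constₚ-*ₚ (+ ε) (powₚ (δ R) g) m))

    coeff-det-μ : coeff (det M) μ ≡ + ε ℤ.* sign ℤ.^ g [mod p ]
    coeff-det-μ = mod-trans (coeff-det-εδ^g μ) (mod-reflexive (cong (+ ε ℤ.*_) coeff-δ^g-μ))

    coeff-det-μ≢0 : coeff (det M) μ ≢ + 0
    coeff-det-μ≢0 coeff≡0 = ∤-unit-multiple (sign ℤ.^ g) (^-unit sign sign²≡1 g) 1≤ε ε<p
      (subst (+ p ∣_) (ℤP.+-identityʳ _)
        (divides-difference (mod-trans (mod-sym coeff-det-μ) (mod-reflexive coeff≡0))))

    μ-satisfies : ∀ {Q : Vec ℕ R → Set} → Dec (Q μ) → AllTerms Q (det M) → Q μ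
    μ-satisfies Q? all = coeff≢0⇒satisfies Q? all coeff-det-μ≢0

  g-formula : + g ℤ.* + (R * (R ∸ 1)) ≡ + (2 * R * e * D) ℤ.- + (D * (D + 1) * (p ∸ 1))
  g-formula = trans (sym (ℤP.pos-* g (R * (R ∸ 1)))) (m+n≡o⇒+m≡+o-+n
    (degree-equation⇒g-formula {P = suc P} {e} {R} twice-degree-μ (twice-sum-toℕ D) degree-μ))
    where
    degree-μ : degree μ + ((D + sum (toℕ {D})) * p + sum (toℕ {D})) ≡ D * (e * R + D)
    degree-μ = subst (λ N → degree μ + (N + sum (toℕ {D})) ≡ D * (e * R + D)) rows
      (μ-satisfies (_ ℕ.≟ _)
        (det-homogeneous M (λ i → suc (toℕ i) * p) toℕ _ (entry-homogeneous {p} {R} {e} {D} D≤p)))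
      where
      rows : sum (λ (i : Fin D) → suc (toℕ i) * p) ≡ (D + sum (toℕ {D})) * p
      rows = begin
        sum (λ (i : Fin D) → suc (toℕ i) * p)
          ≡⟨ *-distribʳ-sum {D} p (λ i → suc (toℕ i)) ⟨
        sum (λ (i : Fin D) → suc (toℕ i)) * p
          ≡⟨ cong (_* p) (∑-distrib-+ {D} (λ _ → 1) toℕ) ⟩
        (sum (λ (_ : Fin D) → 1) + sum (toℕ {D})) * p
          ≡⟨ cong (λ x → (x + sum (toℕ {D})) * p) (sum-ones D) ⟩
        (D + sum (toℕ {D})) * p ∎
        where open ≡-Reasoning

  lower-bound : D * (p ∸ 1) ≤ R * e
  lower-bound =
    μ-satisfies (_ ℕ.≤? _) (det-row-in-ideal Bound (λ _ _ b → b) (λ _ _ b → b) M (Fin.fromℕ d) last-row)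
    where
    Bound : Vec ℕ R → Set
    Bound _ = D * (p ∸ 1) ≤ R * e
    last-row : ∀ j → AllTerms Bound (M (Fin.fromℕ d) j)
    last-row j = All.map (λ {t} → bound (proj₂ t)) (entry-homogeneous {p} {R} {e} {D} D≤p (Fin.fromℕ d) j)
      where
      bound : ∀ a → degree a + (suc (toℕ (Fin.fromℕ d)) * p + toℕ j) ≡ e * R + D → Bound a
      bound a deg-eq = ℕP.+-cancelʳ-≤ D _ _ (begin
        D * (p ∸ 1) + D                                    ≡⟨ ℕP.+-comm _ D ⟩
        D + D * suc P                                      ≡⟨ ℕP.*-suc D (suc P) ⟨
        D * p                                              ≡⟨ cong (λ i → suc i * p) (FinP.toℕ-fromℕ d) ⟨
        suc (toℕ (Fin.fromℕ d)) * p                        ≤⟨ ℕP.m≤m+n _ (toℕ j) ⟩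
        suc (toℕ (Fin.fromℕ d)) * p + toℕ j                ≤⟨ ℕP.m≤n+m _ (degree a) ⟩
        degree a + (suc (toℕ (Fin.fromℕ d)) * p + toℕ j)   ≡⟨ deg-eq ⟩
        e * R + D                                          ≡⟨ cong (_+ D) (ℕP.*-comm e R) ⟩
        R * e + D                                          ∎)
        where open ℕP.≤-Reasoning

  upper-bound : e ≤ p ∸ 1
  upper-bound with e ℕ.≤? p ∸ 1
  ... | yes e≤p-1 = e≤p-1
  ... | no e≰p-1 = ⊥-elim (ℕP.<-irrefl (sym x₁-free-μ) (μ-satisfies (_ ℕ.≤? _)
          (det-row-in-ideal (λ a → 1 ≤ Vec.head a) x₁-divides-⊕ˡ x₁-divides-⊕ʳ M Fin.zero
            (first-row-in-x₁ D≤p (ℕP.≰⇒> e≰p-1)))))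

  g-even : Prime p → p ≢ 2 → 2 ℕD.∣ g
  g-even p-prime p≢2 with even-or-odd g
  ... | q , inj₁ g≡q+q = ℕD.divides q (trans g≡q+q (trans (cong (_+_ q) (sym (ℕP.+-identityʳ q))) (ℕP.*-comm 2 q)))
  ... | q , inj₂ g≡1+q+q =
    ⊥-elim (p≢2 (∣-twice-unit-multiple⇒≡2 (sign ℤ.^ g) (^-unit sign sign²≡1 g) p-prime 1≤ε ε<p (-x≡x⇒∣2x -εt≡εt)))
    where
    coeff-det-swap₁₂-μ : coeff (det M) (swap₁₂ μ) ≡ ℤ.- (+ ε ℤ.* sign ℤ.^ g) [mod p ]
    coeff-det-swap₁₂-μ = mod-trans (coeff-det-εδ^g (swap₁₂ μ)) (mod-reflexive (begin
      + ε ℤ.* coeff (powₚ (δ R) g) (swap₁₂ μ)   ≡⟨ cong (+ ε ℤ.*_) coeff-δ^g-swap₁₂-μ ⟩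
      + ε ℤ.* (ℤ.- sign) ℤ.^ g                  ≡⟨ cong (+ ε ℤ.*_) (neg-^-odd sign q g≡1+q+q) ⟩
      + ε ℤ.* ℤ.- (sign ℤ.^ g)                  ≡⟨ ℤP.neg-distribʳ-* (+ ε) (sign ℤ.^ g) ⟨
      ℤ.- (+ ε ℤ.* sign ℤ.^ g)                  ∎))
      where open ≡-Reasoning
    -εt≡εt : ℤ.- (+ ε ℤ.* sign ℤ.^ g) ≡ + ε ℤ.* sign ℤ.^ g [mod p ]
    -εt≡εt = mod-trans (mod-sym coeff-det-swap₁₂-μ) (mod-trans (coeff-det-swap₁₂ p r e D μ) coeff-det-μ)

lemma4 : (p : ℕ) → Prime p → (r e d : ℕ) → InA p r e d → InU p r e d
lemma4 0 p-prime _ _ _ _ = ⊥-elim (ℕ.NonTrivial.nonTrivial (prime⇒nonTrivial p-prime))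
lemma4 1 p-prime _ _ _ _ = ⊥-elim (ℕ.NonTrivial.nonTrivial (prime⇒nonTrivial p-prime))
lemma4 (suc (suc P)) _ 0 _ _ (() , _)
lemma4 (suc (suc P)) _ 1 _ _ (s≤s () , _)
lemma4 (suc (suc P)) _ (suc (suc r)) _ 0 (_ , _ , () , _)
lemma4 (suc (suc P)) p-prime (suc (suc r)) e (suc d) (2≤r , 1≤e , 1≤d , d≤p , ε , 1≤ε , ε<p , g , 1≤g , det≈εδ^g) =
  2≤r , 1≤e , 1≤d , d≤p , lower-bound , ℕP.*-monoʳ-≤ (suc (suc r)) upper-bound ,
  + g , g-formula , ℤ.+<+ 1≤g , g-even p-prime
  where open DeterminantFormula P r e d {ε} {g} 1≤ε ε<p d≤p (≈⇒≃ det≈εδ^g)
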